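{- Let $n \ge 2$, $N = 2^n$, and let $\eta$ be a bijection from the vertex set $\{0,1\}^n$ of the hypercube $Q_n$ to $\mathbb{Z}_N$. Let $x = \frac{2^n + (-1)^{n+1}}{3}$. Suppose there exist a coordinate $i \in \{1,\dots,n\}$, a value $b \in \{0,1\}$, and an arc $A$ of $2^{n-1}$ consecutive positions of the cycle $\mathbb{Z}_N$ such that at least $x$ vertices $v$ with $v_i = b$ satisfy $\eta(v) \in A$. Then for every routing of the edges of $Q_n$ on the cycle, there is a gap of the cycle through which at least $\frac{5 \cdot 2^{n-2} - 1}{3}$ edges are routed if $n$ is odd, and at least $\frac{5 \cdot 2^{n-2} - 2}{3}$ edges if $n$ is even. In particular, the cyclic cutwidth of $Q_n$ with respect to $\eta$ is at least these values.
   Context: $Q_n$ is the graph on $\{0,1\}^n$ with two vertices adjacent iff they differ in exactly one coordinate. The cycle $\mathbb{Z}_N$ has $N$ gaps, the gap $g_j$ lying between consecutive positions $j$ and $j+1 \pmod N$. A routing assigns to each edge $\{v,w\}$ of $Q_n$ one of the two arcs of the cycle joining $\eta(v)$ and $\eta(w)$; the edge is then said to pass through every gap on that arc. The cut at a gap is the number of edges passing through it, and the cyclic cutwidth $\mathrm{ccw}(Q_n,\eta)$ is the minimum over routings of the maximum cut over all gaps. An arc of $2^{n-1}$ consecutive positions is a set $\{j, j+1, \dots, j+2^{n-1}-1\} \pmod N$. (The hypothesis says there is "at least a $\frac{2^n + (-1)^{n+1}}{3} / \frac{2^{n-1}+(-1)^n}{3}$ split" for a pair of complementary $Q_{n-1}$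 subcubes with respect to a diameter of the cycle.) -}

module Defs where

open import Data.Bool using (Bool; true; false; if_then_else_)
open import Data.Nat using (ℕ; zero; suc; _+_; _*_; _∸_; _^_; _≤_; _<_; _<ᵇ_; _/_)
open import Data.Fin using (Fin; toℕ)
open import Data.List using (List; []; _∷_; _++_; map; length; filter; cartesianProduct; allFin)
open import Data.Vec using (Vec; []; _∷_; lookup)
open import Data.Product using (_×_; _,_)
open import Data.Bool.Properties using () renaming (_≟_ to _≟ᵇ_)
open import Relation.Nullary using (Dec; _×-dec_)
open import Relation.Unary using (Pred; Decidable)
open import Relation.Binary.PropositionalEquality using (_≡_)
open import Function.Bundles using (_⤖_; Bijection)
open import Data.Nat.Properties using (_<?_)

Vertex : ℕ → Set
Vertex n = Vec Bool n

allVertices : (n : ℕ) → List (Vertex n)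
allVertices zero = [] ∷ []
allVertices (suc n) = map (false ∷_) (allVertices n) ++ map (true ∷_) (allVertices n)

flip : ∀ {n} → Vertex n → Fin n → Vertex n
flip (x ∷ v) Fin.zero = (if x then false else true) ∷ v
flip (x ∷ v) (Fin.suc i) = x ∷ flip v i

count : ∀ {a} {A : Set a} {p} {P : Pred A p} → Decidable P → List A → ℕ
count P? xs = length (filter P? xs)

-- Clockwise distance from position a to position b on the cycle Z_N
-- (for a, b < N): the number k < N with a + k ≡ b (mod N).
cw : ℕ → ℕ → ℕ → ℕ
cw N a b = if b <ᵇ a then (b + N) ∸ a else b ∸ a

Embedding : ℕ → Set
Embedding n = Vertex n ⤖ Fin (2 ^ n)

-- Each edge {v, flip v i} of Q_n is represented exactly once by the pair
-- (v , i) with v_i = 0 (false).  A routing chooses, for every edge, one of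
-- the two arcs: true = the clockwise arc from η(v) to η(flip v i),
-- false = the clockwise arc from η(flip v i) to η(v).
-- (Values on pairs with v_i = 1 are irrelevant.)
Routing : ℕ → Set
Routing n = Vertex n → Fin n → Bool

-- The clockwise arc from a to b passes through gap g_j (between j and j+1)
-- iff cw a j < cw a b.
onArc : (N a b j : ℕ) → Set
onArc N a b j = cw N a j < cw N a b

passes : ∀ {n} → Embedding n → Routing n → Fin (2 ^ n) → Vertex n × Fin n → Set
passes {n} η ρ j (v , i) =
  let e = Bijection.to η
      a = toℕ (e v)
      b = toℕ (e (flip v i))
  in if ρ v i then onArc (2 ^ n) a b (toℕ j) else onArc (2 ^ n) b a (toℕ j)

passes? : ∀ {n} (η : Embedding n) (ρ : Routing n) (j : Fin (2 ^ n)) → Decidable (passes η ρ j)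
passes? {n} η ρ j (v , i) with ρ v i
... | true  = cw (2 ^ n) a (toℕ j) <? cw (2 ^ n) a b
  where a = toℕ (Bijection.to η v)
        b = toℕ (Bijection.to η (flip v i))
... | false = cw (2 ^ n) b (toℕ j) <? cw (2 ^ n) b a
  where a = toℕ (Bijection.to η v)
        b = toℕ (Bijection.to η (flip v i))

isEdge? : ∀ {n} → Decidable (λ (p : Vertex n × Fin n) → lookup (Data.Product.proj₁ p) (Data.Product.proj₂ p) ≡ false)
isEdge? (v , i) = lookup v i ≟ᵇ false

cut : ∀ {n} → Embedding n → Routing n → Fin (2 ^ n) → ℕ
cut {n} η ρ j = count (λ p → isEdge? p ×-dec passes? η ρ j p)
                      (cartesianProduct (allVertices n) (allFin n))

isEven : ℕ → Bool
isEven zero = true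
isEven (suc zero) = false
isEven (suc (suc n)) = isEven n

xval : ℕ → ℕ
xval n = if isEven n then (2 ^ n ∸ 1) / 3 else (2 ^ n + 1) / 3

bound : ℕ → ℕ
bound n = if isEven n then (5 * 2 ^ (n ∸ 2) ∸ 2) / 3 else (5 * 2 ^ (n ∸ 2) ∸ 1) / 3

inArcCount : ∀ {n} → Embedding n → Fin n → Bool → Fin (2 ^ n) → ℕ
inArcCount {n} η i b j =
  count (λ v → (lookup v i ≟ᵇ b) ×-dec (cw (2 ^ n) (toℕ j) (toℕ (Bijection.to η v)) <? 2 ^ (n ∸ 1)))
        (allVertices n)

-- Harper's edge-isoperimetric inequality: k vertices of a hypercube span at most h k edges, where
-- h a + h b + min a b ≤ h (a + b).  Counting degrees in each half, a vertex set P of Q_(m+1) whose two halves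
-- across coordinate i have sizes X and Y has at least m (X + Y) + X ∸ (2 h X + 2 h Y + Y) boundary edges.
-- Now slide an arc of 2^(n-1) positions around the cycle, starting from the given one: the number of
-- its vertices with v_i = b changes by at most one per step and goes from ≥ x to ≤ x (at the
-- complementary arc), so some arc S contains exactly x of them.  For X = x and Y = 2^(n-1) ∸ x the
-- values of h are explicit, and the bound above gives at least 2 · bound ∸ 1 boundary edges of S.
-- Each of them is routed through one of the two gaps at the ends of S, so one of those two gaps
-- carries at least bound edges.
module Submission where

open import Defs
open import Data.Bool using (Bool; true; false; not; _∧_; _xor_)
open import Data.Bool.Properties using () renaming (_≟_ to _≟ᵇ_)
open import Data.Nat
open import Data.Nat.Properties
open import Data.Nat.Induction using (<-rec)
open import Data.Nat.DivMod using (m*n/n≡m)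
open import Data.Nat.Tactic.RingSolver using (solve-∀)
open import Data.Fin using (Fin; toℕ; fromℕ<) renaming (zero to fz; suc to fs)
open import Data.Fin.Properties using (toℕ<n; toℕ-fromℕ<)
open import Data.List using (List; []; _∷_; _++_; map; cartesianProduct; allFin; tabulate)
open import Data.Vec using ([]; _∷_; lookup; insertAt)
open import Data.Vec.Properties using (insertAt-lookup)
open import Data.Product using (∃; ∃-syntax; _×_; _,_; proj₁; proj₂)
open import Data.Sum using (_⊎_; inj₁; inj₂)
open import Relation.Nullary using (yes; no; does; contradiction; _×-dec_)
open import Relation.Nullary.Decidable using (dec-true; dec-false)
open import Relation.Nullary.Reflects using (ofʸ; ofⁿ)
open import Relation.Unary using (Pred; Decidable)
open import Relation.Binary.PropositionalEquality
open import Algebra.Properties.CommutativeSemigroup +-commutativeSemigroup using (interchange)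
open import Function using (_∘_)
open import Function.Bundles using (Bijection)

𝟙 : Bool → ℕ
𝟙 true  = 1
𝟙 false = 0

sumV : ∀ n → (Vertex n → ℕ) → ℕ
sumV zero    F = F []
sumV (suc n) F = sumV n (F ∘ (false ∷_)) + sumV n (F ∘ (true ∷_))

sumFin : ∀ n → (Fin n → ℕ) → ℕ
sumFin zero    f = 0
sumFin (suc n) f = f fz + sumFin n (f ∘ fs)

sumBelow : ℕ → (ℕ → ℕ) → ℕ
sumBelow zero    f = 0
sumBelow (suc n) f = sumBelow n f + f n

sumList : ∀ {a} {A : Set a} → (A → ℕ) → List A → ℕ
sumList f []       = 0
sumList f (x ∷ xs) = f x + sumList f xs

sumV-cong : ∀ n {F G : Vertex n → ℕ} → (∀ v → F v ≡ G v) → sumV n F ≡ sumV n G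
sumV-cong zero    e = e []
sumV-cong (suc n) e = cong₂ _+_ (sumV-cong n (e ∘ (false ∷_))) (sumV-cong n (e ∘ (true ∷_)))

sumV-mono : ∀ n {F G : Vertex n → ℕ} → (∀ v → F v ≤ G v) → sumV n F ≤ sumV n G
sumV-mono zero    e = e []
sumV-mono (suc n) e = +-mono-≤ (sumV-mono n (e ∘ (false ∷_))) (sumV-mono n (e ∘ (true ∷_)))

sumV-+ : ∀ n (F G : Vertex n → ℕ) → sumV n (λ v → F v + G v) ≡ sumV n F + sumV n G
sumV-+ zero    F G = refl
sumV-+ (suc n) F G =
  trans (cong₂ _+_ (sumV-+ n (F ∘ (false ∷_)) (G ∘ (false ∷_))) (sumV-+ n (F ∘ (true ∷_)) (G ∘ (true ∷_))))
        (interchange (sumV n (F ∘ (false ∷_))) (sumV n (G ∘ (false ∷_))) (sumV n (F ∘ (true ∷_))) (sumV n (G ∘ (true ∷_))))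

sumV-* : ∀ n c (F : Vertex n → ℕ) → sumV n (λ v → c * F v) ≡ c * sumV n F
sumV-* zero    c F = refl
sumV-* (suc n) c F = trans (cong₂ _+_ (sumV-* n c _) (sumV-* n c _)) (sym (*-distribˡ-+ c _ _))

sumV-const : ∀ n c → sumV n (λ _ → c) ≡ 2 ^ n * c
sumV-const zero    c = sym (+-identityʳ c)
sumV-const (suc n) c = begin
  sumV n (λ _ → c) + sumV n (λ _ → c) ≡⟨ cong₂ _+_ (sumV-const n c) (sumV-const n c) ⟩
  2 ^ n * c + 2 ^ n * c               ≡⟨ double (2 ^ n) c ⟩
  2 * 2 ^ n * c                       ∎
  where
  open ≡-Reasoning
  double : ∀ a c → a * c + a * c ≡ 2 * a * c
  double = solve-∀

sumV-term : ∀ n (F : Vertex n → ℕ) w → F w ≤ sumV n F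
sumV-term zero    F []          = ≤-refl
sumV-term (suc n) F (false ∷ w) = ≤-trans (sumV-term n (F ∘ (false ∷_)) w) (m≤m+n _ _)
sumV-term (suc n) F (true ∷ w)  = ≤-trans (sumV-term n (F ∘ (true ∷_)) w) (m≤n+m _ _)

sumFin-mono : ∀ n {f g : Fin n → ℕ} → (∀ i → f i ≤ g i) → sumFin n f ≤ sumFin n g
sumFin-mono zero    e = z≤n
sumFin-mono (suc n) e = +-mono-≤ (e fz) (sumFin-mono n (e ∘ fs))

sumFin-+ : ∀ n (f g : Fin n → ℕ) → sumFin n (λ i → f i + g i) ≡ sumFin n f + sumFin n g
sumFin-+ zero    f g = refl
sumFin-+ (suc n) f g =
  trans (cong (f fz + g fz +_) (sumFin-+ n (f ∘ fs) (g ∘ fs))) (interchange (f fz) (g fz) (sumFin n (f ∘ fs)) (sumFin n (g ∘ fs)))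

sumBelow-cong : ∀ n {f g : ℕ → ℕ} → (∀ d → d < n → f d ≡ g d) → sumBelow n f ≡ sumBelow n g
sumBelow-cong zero    e = refl
sumBelow-cong (suc n) e = cong₂ _+_ (sumBelow-cong n (λ d d<n → e d (m<n⇒m<1+n d<n))) (e n ≤-refl)

sumBelow-+ : ∀ n (f g : ℕ → ℕ) → sumBelow n (λ d → f d + g d) ≡ sumBelow n f + sumBelow n g
sumBelow-+ zero    f g = refl
sumBelow-+ (suc n) f g = trans (cong (_+ (f n + g n)) (sumBelow-+ n f g)) (interchange (sumBelow n f) (sumBelow n g) (f n) (g n))

sumV-sumBelow-swap : ∀ n N (F : Vertex n → ℕ → ℕ) →
  sumV n (λ v → sumBelow N (F v)) ≡ sumBelow N (λ d → sumV n (λ v → F v d))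
sumV-sumBelow-swap n zero    F = trans (sumV-const n 0) (*-zeroʳ (2 ^ n))
sumV-sumBelow-swap n (suc N) F =
  trans (sumV-+ n _ _) (cong (_+ sumV n (λ v → F v N)) (sumV-sumBelow-swap n N F))

count≡sumList : ∀ {a p} {A : Set a} {P : Pred A p} (P? : Decidable P) xs →
  count P? xs ≡ sumList (λ x → 𝟙 (does (P? x))) xs
count≡sumList P? [] = refl
count≡sumList P? (x ∷ xs) with does (P? x)
... | true  = cong suc (count≡sumList P? xs)
... | false = count≡sumList P? xs

sumList-++ : ∀ {a} {A : Set a} (f : A → ℕ) xs ys → sumList f (xs ++ ys) ≡ sumList f xs + sumList f ys
sumList-++ f []       ys = refl
sumList-++ f (x ∷ xs) ys = trans (cong (f x +_) (sumList-++ f xs ys)) (sym (+-assoc (f x) _ _))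

sumList-map : ∀ {a b} {A : Set a} {B : Set b} (f : B → ℕ) (g : A → B) xs →
  sumList f (map g xs) ≡ sumList (f ∘ g) xs
sumList-map f g []       = refl
sumList-map f g (x ∷ xs) = cong (f (g x) +_) (sumList-map f g xs)

sumList-cartesianProduct : ∀ {a b} {A : Set a} {B : Set b} (f : A × B → ℕ) xs ys →
  sumList f (cartesianProduct xs ys) ≡ sumList (λ x → sumList (λ y → f (x , y)) ys) xs
sumList-cartesianProduct f []       ys = refl
sumList-cartesianProduct f (x ∷ xs) ys = trans (sumList-++ f (map (x ,_) ys) _)
  (cong₂ _+_ (sumList-map f (x ,_) ys) (sumList-cartesianProduct f xs ys))

sumList-allVertices : ∀ n (f : Vertex n → ℕ) → sumList f (allVertices n) ≡ sumV n f
sumList-allVertices zero    f = +-identityʳ _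
sumList-allVertices (suc n) f = trans (sumList-++ f (map (false ∷_) (allVertices n)) _)
  (cong₂ _+_ (trans (sumList-map f _ (allVertices n)) (sumList-allVertices n _))
             (trans (sumList-map f _ (allVertices n)) (sumList-allVertices n _)))

sumList-allFin : ∀ n (f : Fin n → ℕ) → sumList f (allFin n) ≡ sumFin n f
sumList-allFin n f = go n f (λ i → i)
  where
  go : ∀ n {B : Set} (f : B → ℕ) (g : Fin n → B) → sumList f (tabulate g) ≡ sumFin n (f ∘ g)
  go zero    f g = refl
  go (suc n) f g = cong (f (g fz) +_) (go n f (g ∘ fs))

-- Harper's function

even⊎odd : ∀ a → (∃[ d ] a ≡ d + d) ⊎ (∃[ d ] a ≡ suc (d + d))
even⊎odd zero          = inj₁ (0 , refl)
even⊎odd (suc zero)    = inj₂ (0 , refl)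
even⊎odd (suc (suc a)) with even⊎odd a
... | inj₁ (d , refl) = inj₁ (suc d , cong suc (sym (+-suc d d)))
... | inj₂ (d , refl) = inj₂ (suc d , cong (λ z → suc (suc z)) (sym (+-suc d d)))

⌊1+n+n/2⌋≡n : ∀ n → ⌊ suc (n + n) /2⌋ ≡ n
⌊1+n+n/2⌋≡n zero    = refl
⌊1+n+n/2⌋≡n (suc n) rewrite +-suc n n = cong suc (⌊1+n+n/2⌋≡n n)

-- h k is the largest number of edges of a hypercube spanned by k of its vertices.
-- Its recursion only ever halves k, so k is enough fuel.
harperFuel : ℕ → ℕ → ℕ
harperFuel zero    k = 0
harperFuel (suc t) k = harperFuel t ⌈ k /2⌉ + harperFuel t ⌊ k /2⌋ + ⌊ k /2⌋

harper : ℕ → ℕ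
harper k = harperFuel k k

harperFuel-0 : ∀ t → harperFuel t 0 ≡ 0
harperFuel-0 zero    = refl
harperFuel-0 (suc t) rewrite harperFuel-0 t = refl

harperFuel-1 : ∀ t → harperFuel t 1 ≡ 0
harperFuel-1 zero    = refl
harperFuel-1 (suc t) rewrite harperFuel-1 t | harperFuel-0 t = refl

⌈2+n/2⌉≤1+n : ∀ n → ⌈ suc (suc n) /2⌉ ≤ suc n
⌈2+n/2⌉≤1+n n = s≤s⁻¹ (⌈n/2⌉<n n)

⌊2+n/2⌋≤1+n : ∀ n → ⌊ suc (suc n) /2⌋ ≤ suc n
⌊2+n/2⌋≤1+n n = ≤-trans (⌊n/2⌋≤⌈n/2⌉ (suc (suc n))) (⌈2+n/2⌉≤1+n n)

harperFuel-stable : ∀ s t k → k ≤ s → k ≤ t → harperFuel s k ≡ harperFuel t k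
harperFuel-stable s t zero          _ _ = trans (harperFuel-0 s) (sym (harperFuel-0 t))
harperFuel-stable s t (suc zero)    _ _ = trans (harperFuel-1 s) (sym (harperFuel-1 t))
harperFuel-stable (suc s) (suc t) (suc (suc k)) (s≤s k<s) (s≤s k<t) =
  cong₂ (λ p q → p + q + ⌊ suc (suc k) /2⌋)
    (harperFuel-stable s t _ (≤-trans (⌈2+n/2⌉≤1+n k) k<s) (≤-trans (⌈2+n/2⌉≤1+n k) k<t))
    (harperFuel-stable s t _ (≤-trans (⌊2+n/2⌋≤1+n k) k<s) (≤-trans (⌊2+n/2⌋≤1+n k) k<t))

harper-unfold : ∀ k → 2 ≤ k → harper k ≡ harper ⌈ k /2⌉ + harper ⌊ k /2⌋ + ⌊ k /2⌋
harper-unfold (suc zero) (s≤s ())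
harper-unfold (suc (suc k)) _ =
  cong₂ (λ p q → p + q + ⌊ suc (suc k) /2⌋)
    (harperFuel-stable (suc k) _ _ (⌈2+n/2⌉≤1+n k) ≤-refl)
    (harperFuel-stable (suc k) _ _ (⌊2+n/2⌋≤1+n k) ≤-refl)

harper-double : ∀ a → harper (a + a) ≡ harper a + harper a + a
harper-double zero    = refl
harper-double (suc a) = trans (harper-unfold (suc a + suc a) (s≤s (≤-trans (s≤s z≤n) (m≤n+m (suc a) a))))
  (cong₂ (λ p q → harper p + harper q + q) (⌊1+n+n/2⌋≡n (suc a)) (sym (n≡⌊n+n/2⌋ (suc a))))

harper-double+1 : ∀ a → harper (suc (a + a)) ≡ harper (suc a) + harper a + a
harper-double+1 zero    = refl
harper-double+1 (suc a) = trans (harper-unfold (suc (suc a + suc a)) (s≤s (s≤s z≤n)))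
  (cong₂ (λ p q → harper p + harper q + q) (cong suc (sym (n≡⌊n+n/2⌋ (suc a)))) (⌊1+n+n/2⌋≡n (suc a)))

SuperadditiveBelow : ℕ → Set
SuperadditiveBelow n = ∀ a b c → a + b < n → c ≤ a → c ≤ b → harper a + harper b + c ≤ harper (a + b)

private
  superadditive-even-even : ∀ a b → SuperadditiveBelow ((a + b) + (a + b)) → 1 ≤ b → b ≤ a →
    harper (a + a) + harper (b + b) + (b + b) ≤ harper ((a + b) + (a + b))
  superadditive-even-even a b ih 1≤b b≤a = begin
    harper (a + a) + harper (b + b) + (b + b)
      ≡⟨ cong₂ (λ p q → p + q + (b + b)) (harper-double a) (harper-double b) ⟩
    (harper a + harper a + a) + (harper b + harper b + b) + (b + b)
      ≡⟨ regroup (harper a) (harper b) a b ⟩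
    (harper a + harper b + b) + (harper a + harper b + b) + (a + b)
      ≤⟨ +-monoˡ-≤ (a + b) (+-mono-≤ halves halves) ⟩
    harper (a + b) + harper (a + b) + (a + b)
      ≡⟨ harper-double (a + b) ⟨
    harper ((a + b) + (a + b)) ∎
    where
    open ≤-Reasoning
    halves : harper a + harper b + b ≤ harper (a + b)
    halves = ih a b b (m<m+n (a + b) (≤-trans 1≤b (m≤n+m b a))) b≤a ≤-refl
    regroup : ∀ A B a b → (A + A + a) + (B + B + b) + (b + b) ≡ (A + B + b) + (A + B + b) + (a + b)
    regroup = solve-∀

  superadditive-odd-even : ∀ a b → SuperadditiveBelow (suc ((a + b) + (a + b))) → 1 ≤ b → b ≤ a →
    harper (suc (a + a)) + harper (b + b) + (b + b) ≤ harper (suc ((a + b) + (a + b)))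
  superadditive-odd-even a b ih 1≤b b≤a = begin
    harper (suc (a + a)) + harper (b + b) + (b + b)
      ≡⟨ cong₂ (λ p q → p + q + (b + b)) (harper-double+1 a) (harper-double b) ⟩
    (harper (suc a) + harper a + a) + (harper b + harper b + b) + (b + b)
      ≡⟨ regroup (harper (suc a)) (harper a) (harper b) a b ⟩
    (harper (suc a) + harper b + b) + (harper a + harper b + b) + (a + b)
      ≤⟨ +-monoˡ-≤ (a + b) (+-mono-≤ (ih (suc a) b b (s≤s ab<) (m≤n⇒m≤1+n b≤a) ≤-refl)
                                      (ih a b b (m<n⇒m<1+n ab<) b≤a ≤-refl)) ⟩
    harper (suc (a + b)) + harper (a + b) + (a + b)
      ≡⟨ harper-double+1 (a + b) ⟨
    harper (suc ((a + b) + (a + b))) ∎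
    where
    open ≤-Reasoning
    ab< : a + b < (a + b) + (a + b)
    ab< = m<m+n (a + b) (≤-trans 1≤b (m≤n+m b a))
    regroup : ∀ S A B a b → (S + A + a) + (B + B + b) + (b + b) ≡ (S + B + b) + (A + B + b) + (a + b)
    regroup = solve-∀

  superadditive-even-odd : ∀ a b → SuperadditiveBelow (suc ((a + b) + (a + b))) → suc b ≤ a →
    harper (a + a) + harper (suc (b + b)) + suc (b + b) ≤ harper (suc ((a + b) + (a + b)))
  superadditive-even-odd a b ih b<a = begin
    harper (a + a) + harper (suc (b + b)) + suc (b + b)
      ≡⟨ cong₂ (λ p q → p + q + suc (b + b)) (harper-double a) (harper-double+1 b) ⟩
    (harper a + harper a + a) + (harper (suc b) + harper b + b) + suc (b + b)
      ≡⟨ regroup (harper a) (harper (suc b)) (harper b) a b ⟩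
    (harper a + harper (suc b) + suc b) + (harper a + harper b + b) + (a + b)
      ≤⟨ +-monoˡ-≤ (a + b) (+-mono-≤ (ih a (suc b) (suc b) (subst (_< suc ((a + b) + (a + b))) (sym (+-suc a b)) (s≤s ab<)) b<a ≤-refl)
                                      (ih a b b (m<n⇒m<1+n ab<) (≤-trans (n≤1+n b) b<a) ≤-refl)) ⟩
    harper (a + suc b) + harper (a + b) + (a + b)
      ≡⟨ cong (λ z → harper z + harper (a + b) + (a + b)) (+-suc a b) ⟩
    harper (suc (a + b)) + harper (a + b) + (a + b)
      ≡⟨ harper-double+1 (a + b) ⟨
    harper (suc ((a + b) + (a + b))) ∎
    where
    open ≤-Reasoning
    ab< : a + b < (a + b) + (a + b)
    ab< = m<m+n (a + b) (≤-trans (≤-trans (s≤s z≤n) b<a) (m≤m+n a b))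
    regroup : ∀ A S B a b → (A + A + a) + (S + B + b) + suc (b + b) ≡ (A + S + suc b) + (A + B + b) + (a + b)
    regroup = solve-∀

  superadditive-odd-odd : ∀ a b → SuperadditiveBelow (suc (a + b) + suc (a + b)) → b ≤ a →
    harper (suc (a + a)) + harper (suc (b + b)) + suc (b + b) ≤ harper (suc (a + b) + suc (a + b))
  superadditive-odd-odd a b ih b≤a = begin
    harper (suc (a + a)) + harper (suc (b + b)) + suc (b + b)
      ≡⟨ cong₂ (λ p q → p + q + suc (b + b)) (harper-double+1 a) (harper-double+1 b) ⟩
    (harper (suc a) + harper a + a) + (harper (suc b) + harper b + b) + suc (b + b)
      ≡⟨ regroup (harper (suc a)) (harper a) (harper (suc b)) (harper b) a b ⟩
    (harper (suc a) + harper b + b) + (harper a + harper (suc b) + b) + suc (a + b)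
      ≤⟨ +-monoˡ-≤ (suc (a + b)) (+-mono-≤ (ih (suc a) b b ab< (m≤n⇒m≤1+n b≤a) ≤-refl)
                                            (ih a (suc b) b (subst (_< suc (a + b) + suc (a + b)) (sym (+-suc a b)) ab<) b≤a (n≤1+n b))) ⟩
    harper (suc (a + b)) + harper (a + suc b) + suc (a + b)
      ≡⟨ cong (λ z → harper (suc (a + b)) + harper z + suc (a + b)) (+-suc a b) ⟩
    harper (suc (a + b)) + harper (suc (a + b)) + suc (a + b)
      ≡⟨ harper-double (suc (a + b)) ⟨
    harper (suc (a + b) + suc (a + b)) ∎
    where
    open ≤-Reasoning
    ab< : suc (a + b) < suc (a + b) + suc (a + b)
    ab< = m<m+n (suc (a + b)) (s≤s z≤n)
    regroup : ∀ SA A SB B a b → (SA + A + a) + (SB + B + b) + suc (b + b) ≡ (SA + B + b) + (A + SB + b) + suc (a + b)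
    regroup = solve-∀

  SuperadditiveAt : ℕ → Set
  SuperadditiveAt n = ∀ a b → a + b ≡ n → b ≤ a → harper a + harper b + b ≤ harper n

  below : ∀ {n} → (∀ {m} → m < n → SuperadditiveAt m) → SuperadditiveBelow n
  below {n} rec a b c a+b<n c≤a c≤b with ≤-total b a
  ... | inj₁ b≤a = ≤-trans (+-monoʳ-≤ _ c≤b) (rec a+b<n a b refl b≤a)
  ... | inj₂ a≤b = begin
    harper a + harper b + c ≡⟨ cong (_+ c) (+-comm (harper a) (harper b)) ⟩
    harper b + harper a + c ≤⟨ +-monoʳ-≤ _ c≤a ⟩
    harper b + harper a + a ≤⟨ rec (subst (_< n) (+-comm a b) a+b<n) b a refl a≤b ⟩
    harper (b + a)          ≡⟨ cong harper (+-comm b a) ⟩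
    harper (a + b)          ∎
    where open ≤-Reasoning

  superadditive-at : ∀ n → (∀ {m} → m < n → SuperadditiveAt m) → SuperadditiveAt n
  superadditive-at n rec a b eq b≤a with even⊎odd a | even⊎odd b | eq
  ... | _ | inj₁ (zero , refl) | refl =
    ≤-reflexive (trans (+-identityʳ _) (trans (+-identityʳ _) (cong harper (sym (+-identityʳ a)))))
  ... | inj₁ (a , refl) | inj₁ (b@(suc _) , refl) | refl =
    ≤-trans (superadditive-even-even a b (subst SuperadditiveBelow e (below rec)) (s≤s z≤n) half) (≤-reflexive (cong harper (sym e)))
    where
    e : (a + a) + (b + b) ≡ (a + b) + (a + b)
    e = interchange a a b b
    half : b ≤ a
    half = subst₂ _≤_ (sym (n≡⌊n+n/2⌋ b)) (sym (n≡⌊n+n/2⌋ a)) (⌊n/2⌋-mono b≤a)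
  ... | inj₂ (a , refl) | inj₁ (b@(suc _) , refl) | refl =
    ≤-trans (superadditive-odd-even a b (subst SuperadditiveBelow e (below rec)) (s≤s z≤n) half) (≤-reflexive (cong harper (sym e)))
    where
    e : suc (a + a) + (b + b) ≡ suc ((a + b) + (a + b))
    e = cong suc (interchange a a b b)
    half : b ≤ a
    half = subst₂ _≤_ (sym (n≡⌊n+n/2⌋ b)) (⌊1+n+n/2⌋≡n a) (⌊n/2⌋-mono b≤a)
  ... | inj₁ (a , refl) | inj₂ (b , refl) | refl =
    ≤-trans (superadditive-even-odd a b (subst SuperadditiveBelow e (below rec)) half) (≤-reflexive (cong harper (sym e)))
    where
    e : (a + a) + suc (b + b) ≡ suc ((a + b) + (a + b))
    e = trans (+-suc (a + a) (b + b)) (cong suc (interchange a a b b))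
    half : suc b ≤ a
    half = subst₂ _≤_ (cong suc (sym (n≡⌊n+n/2⌋ b))) (⌊1+n+n/2⌋≡n a) (⌈n/2⌉-mono b≤a)
  ... | inj₂ (a , refl) | inj₂ (b , refl) | refl =
    ≤-trans (superadditive-odd-odd a b (subst SuperadditiveBelow e (below rec)) half) (≤-reflexive (cong harper (sym e)))
    where
    e : suc (a + a) + suc (b + b) ≡ suc (a + b) + suc (a + b)
    e = cong suc (trans (+-suc (a + a) (b + b)) (trans (cong suc (interchange a a b b)) (sym (+-suc (a + b) (a + b)))))
    half : b ≤ a
    half = subst₂ _≤_ (⌊1+n+n/2⌋≡n b) (⌊1+n+n/2⌋≡n a) (⌊n/2⌋-mono b≤a)

harper-superadditive : ∀ a b c → c ≤ a → c ≤ b → harper a + harper b + c ≤ harper (a + b)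
harper-superadditive a b c = below (λ {m} _ → <-rec SuperadditiveAt superadditive-at m) a b c (n<1+n (a + b))

-- ones₄ k = (4 ^ k ∸ 1) / 3, whose base-4 digits are all 1.  Both x and 2 ^ (n ∸ 1) ∸ x are
-- of the form ones₄ k or 2 · ones₄ k + 1, where the values of h are known exactly.
ones₄ : ℕ → ℕ
ones₄ zero    = 0
ones₄ (suc k) = suc ((ones₄ k + ones₄ k) + (ones₄ k + ones₄ k))

3*ones₄+1≡4^ : ∀ k → 3 * ones₄ k + 1 ≡ 2 ^ (k + k)
3*ones₄+1≡4^ zero    = refl
3*ones₄+1≡4^ (suc k) = begin
  3 * ones₄ (suc k) + 1   ≡⟨ quadruple (ones₄ k) ⟩
  4 * (3 * ones₄ k + 1)   ≡⟨ cong (4 *_) (3*ones₄+1≡4^ k) ⟩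
  4 * 2 ^ (k + k)         ≡⟨ *-assoc 2 2 (2 ^ (k + k)) ⟩
  2 ^ suc (suc (k + k))   ≡⟨ cong (λ e → 2 ^ suc e) (+-suc k k) ⟨
  2 ^ (suc k + suc k)     ∎
  where
  open ≡-Reasoning
  quadruple : ∀ w → 3 * suc ((w + w) + (w + w)) + 1 ≡ 4 * (3 * w + 1)
  quadruple = solve-∀

harper-ones₄-step : ∀ k → harper (suc (ones₄ k)) ≡ harper (ones₄ k) + k →
  harper (ones₄ (suc k)) ≡ 4 * harper (ones₄ k) + k + 4 * ones₄ k
harper-ones₄-step k h[1+u]≡ = begin
  harper (suc (w + w))
    ≡⟨ harper-double+1 w ⟩
  harper (suc w) + harper w + w
    ≡⟨ cong₂ (λ p q → p + q + w) (harper-double+1 u) (harper-double u) ⟩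
  (harper (suc u) + harper u + u) + (harper u + harper u + u) + (u + u)
    ≡⟨ cong (λ z → (z + harper u + u) + (harper u + harper u + u) + (u + u)) h[1+u]≡ ⟩
  (harper u + k + harper u + u) + (harper u + harper u + u) + (u + u)
    ≡⟨ regroup (harper u) k u ⟩
  4 * harper u + k + 4 * u ∎
  where
  open ≡-Reasoning
  u = ones₄ k
  w = u + u
  regroup : ∀ H k u → (H + k + H + u) + (H + H + u) + (u + u) ≡ 4 * H + k + 4 * u
  regroup = solve-∀

harper-ones₄ : ∀ k → (harper (suc (ones₄ k)) ≡ harper (ones₄ k) + k) × (harper (ones₄ k) + ones₄ k ≡ k * ones₄ k)
harper-ones₄ zero    = refl , refl
harper-ones₄ (suc k) = harper-suc , harper-closed
  where
  open ≡-Reasoning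
  u = ones₄ k
  w = u + u
  ih : (harper (suc u) ≡ harper u + k) × (harper u + u ≡ k * u)
  ih = harper-ones₄ k
  step : harper (ones₄ (suc k)) ≡ 4 * harper u + k + 4 * u
  step = harper-ones₄-step k (proj₁ ih)
  harper-suc : harper (suc (ones₄ (suc k))) ≡ harper (ones₄ (suc k)) + suc k
  harper-suc = begin
    harper (suc (suc (w + w)))
      ≡⟨ cong (harper ∘ suc) (+-suc w w) ⟨
    harper (suc w + suc w)
      ≡⟨ harper-double (suc w) ⟩
    harper (suc w) + harper (suc w) + suc w
      ≡⟨ cong (λ z → z + z + suc w) (trans (harper-double+1 u) (cong (λ z → z + harper u + u) (proj₁ ih))) ⟩
    (harper u + k + harper u + u) + (harper u + k + harper u + u) + suc (u + u)
      ≡⟨ regroup (harper u) k u ⟩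
    (4 * harper u + k + 4 * u) + suc k
      ≡⟨ cong (_+ suc k) step ⟨
    harper (ones₄ (suc k)) + suc k ∎
    where
    regroup : ∀ H k u → (H + k + H + u) + (H + k + H + u) + suc (u + u) ≡ (4 * H + k + 4 * u) + suc k
    regroup = solve-∀
  harper-closed : harper (ones₄ (suc k)) + ones₄ (suc k) ≡ suc k * ones₄ (suc k)
  harper-closed = begin
    harper (ones₄ (suc k)) + ones₄ (suc k)
      ≡⟨ cong (_+ ones₄ (suc k)) step ⟩
    4 * harper u + k + 4 * u + suc (w + w)
      ≡⟨ regroup (harper u) k u ⟩
    4 * (harper u + u) + 4 * u + k + 1
      ≡⟨ cong (λ z → 4 * z + 4 * u + k + 1) (proj₂ ih) ⟩
    4 * (k * u) + 4 * u + k + 1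
      ≡⟨ expand k u ⟩
    suc k * suc (w + w) ∎
    where
    regroup : ∀ H k u → 4 * H + k + 4 * u + suc ((u + u) + (u + u)) ≡ 4 * (H + u) + 4 * u + k + 1
    regroup = solve-∀
    expand : ∀ k u → 4 * (k * u) + 4 * u + k + 1 ≡ suc k * suc ((u + u) + (u + u))
    expand = solve-∀

isEven-double : ∀ k → isEven (k + k) ≡ true
isEven-double zero    = refl
isEven-double (suc k) rewrite +-suc k k = isEven-double k

isEven-double+1 : ∀ k → isEven (suc (k + k)) ≡ false
isEven-double+1 zero    = refl
isEven-double+1 (suc k) rewrite +-suc k k = isEven-double+1 k

-- Writing n = 2k + 2 (even) or n = 2k + 3 (odd), the divisions by 3 in xval and bound are exact.
xval-even : ∀ k → xval (suc (suc (k + k))) ≡ 4 * ones₄ k + 1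
xval-even k rewrite isEven-double k | sym (3*ones₄+1≡4^ k) =
  trans (cong (λ z → (z ∸ 1) / 3) (e (ones₄ k))) (m*n/n≡m (4 * ones₄ k + 1) 3)
  where
  e : ∀ U → 2 * (2 * (3 * U + 1)) ≡ suc ((4 * U + 1) * 3)
  e = solve-∀

bound-even : ∀ k → bound (suc (suc (k + k))) ≡ 5 * ones₄ k + 1
bound-even k rewrite isEven-double k | sym (3*ones₄+1≡4^ k) =
  trans (cong (λ z → (z ∸ 2) / 3) (e (ones₄ k))) (m*n/n≡m (5 * ones₄ k + 1) 3)
  where
  e : ∀ U → 5 * (3 * U + 1) ≡ suc (suc ((5 * U + 1) * 3))
  e = solve-∀

xval-odd : ∀ k → xval (suc (suc (suc (k + k)))) ≡ suc (ones₄ (suc k) + ones₄ (suc k))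
xval-odd k rewrite isEven-double+1 k | sym (3*ones₄+1≡4^ k) =
  trans (cong (_/ 3) (e (ones₄ k))) (m*n/n≡m _ 3)
  where
  e : ∀ U → 2 * (2 * (2 * (3 * U + 1))) + 1 ≡ suc (suc ((U + U) + (U + U)) + suc ((U + U) + (U + U))) * 3
  e = solve-∀

bound-odd : ∀ k → bound (suc (suc (suc (k + k)))) ≡ 10 * ones₄ k + 3
bound-odd k rewrite isEven-double+1 k | sym (3*ones₄+1≡4^ k) =
  trans (cong (λ z → (z ∸ 1) / 3) (e (ones₄ k))) (m*n/n≡m (10 * ones₄ k + 3) 3)
  where
  e : ∀ U → 5 * (2 * (3 * U + 1)) ≡ suc ((10 * U + 3) * 3)
  e = solve-∀

2^m≤xval+xval : ∀ m → 1 ≤ m → 2 ^ m ≤ xval (suc m) + xval (suc m)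
2^m≤xval+xval (suc m) _ with even⊎odd m
... | inj₁ (k , refl) rewrite xval-even k | sym (3*ones₄+1≡4^ k) =
  ≤-trans (m≤m+n (2 * (3 * ones₄ k + 1)) (2 * ones₄ k)) (≤-reflexive (sym (e (ones₄ k))))
  where
  e : ∀ U → 4 * U + 1 + (4 * U + 1) ≡ 2 * (3 * U + 1) + 2 * U
  e = solve-∀
... | inj₂ (k , refl) rewrite xval-odd k | sym (3*ones₄+1≡4^ k) =
  ≤-trans (m≤m+n (2 * (2 * (3 * ones₄ k + 1))) (4 * ones₄ k + 2)) (≤-reflexive (sym (e (ones₄ k))))
  where
  e : ∀ U → suc (suc ((U + U) + (U + U)) + suc ((U + U) + (U + U))) + suc (suc ((U + U) + (U + U)) + suc ((U + U) + (U + U)))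
            ≡ 2 * (2 * (3 * U + 1)) + (4 * U + 2)
  e = solve-∀

≤-by-cancelling : ∀ L R P Q → L + P ≡ R + 1 + Q → P ≡ Q → R ≤ L
≤-by-cancelling L R P P e refl = ≤-trans (m≤m+n R 1) (≤-reflexive (sym (+-cancelʳ-≡ P L (R + 1) e)))

-- Once the closed forms of h at ones₄ k are substituted, the two sides differ by exactly 1.
private
  harper-inequality-even : ∀ k y → xval (suc (suc (k + k))) + y ≡ 2 ^ suc (k + k) →
    2 * bound (suc (suc (k + k))) + 2 * harper (xval (suc (suc (k + k)))) + 2 * harper y + y
      ≤ suc (k + k) * (xval (suc (suc (k + k))) + y) + xval (suc (suc (k + k))) + 1
  harper-inequality-even k y x+y≡ rewrite xval-even k | bound-even k = goal
    where
    U = ones₄ k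
    H = harper U
    ih : (harper (suc U) ≡ H + k) × (H + U ≡ k * U)
    ih = harper-ones₄ k
    y≡ : y ≡ suc (U + U)
    y≡ = +-cancelˡ-≡ (4 * U + 1) y (suc (U + U)) (trans x+y≡ (trans (cong (2 *_) (sym (3*ones₄+1≡4^ k))) (e U)))
      where
      e : ∀ U → 2 * (3 * U + 1) ≡ 4 * U + 1 + suc (U + U)
      e = solve-∀
    hx : harper (4 * U + 1) ≡ 4 * H + k + 4 * U
    hx = trans (cong harper (e U)) (harper-ones₄-step k (proj₁ ih))
      where
      e : ∀ U → 4 * U + 1 ≡ suc ((U + U) + (U + U))
      e = solve-∀
    hy : harper (suc (U + U)) ≡ (H + k) + H + U
    hy = trans (harper-double+1 U) (cong (λ z → z + H + U) (proj₁ ih))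
    E : ∀ H k U → (suc (k + k) * (4 * U + 1 + suc (U + U)) + (4 * U + 1) + 1) + 12 * (H + U) ≡
        (2 * (5 * U + 1) + 2 * (4 * H + k + 4 * U) + 2 * ((H + k) + H + U) + suc (U + U)) + 1 + 12 * (k * U)
    E = solve-∀
    goal : 2 * (5 * U + 1) + 2 * harper (4 * U + 1) + 2 * harper y + y ≤ suc (k + k) * (4 * U + 1 + y) + (4 * U + 1) + 1
    goal rewrite y≡ | hx | hy = ≤-by-cancelling _ _ _ _ (E H k U) (cong (12 *_) (proj₂ ih))

  harper-inequality-odd : ∀ k y → xval (suc (suc (suc (k + k)))) + y ≡ 2 ^ suc (suc (k + k)) →
    2 * bound (suc (suc (suc (k + k)))) + 2 * harper (xval (suc (suc (suc (k + k))))) + 2 * harper y + y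
      ≤ suc (suc (k + k)) * (xval (suc (suc (suc (k + k)))) + y) + xval (suc (suc (suc (k + k)))) + 1
  harper-inequality-odd k y x+y≡ rewrite xval-odd k | bound-odd k = goal
    where
    U = ones₄ k
    H = harper U
    u′ = ones₄ (suc k)
    ih : (harper (suc U) ≡ H + k) × (H + U ≡ k * U)
    ih = harper-ones₄ k
    A = 4 * H + k + 4 * U
    y≡ : y ≡ u′
    y≡ = +-cancelˡ-≡ (suc (u′ + u′)) y u′ (trans x+y≡ (trans (cong (λ z → 2 * (2 * z)) (sym (3*ones₄+1≡4^ k))) (e U)))
      where
      e : ∀ U → 2 * (2 * (3 * U + 1)) ≡ suc (suc ((U + U) + (U + U)) + suc ((U + U) + (U + U))) + suc ((U + U) + (U + U))
      e = solve-∀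
    hu′ : harper u′ ≡ A
    hu′ = harper-ones₄-step k (proj₁ ih)
    hx : harper (suc (u′ + u′)) ≡ (A + suc k) + A + u′
    hx = trans (harper-double+1 u′) (cong₂ (λ p q → p + q + u′) (trans (proj₁ (harper-ones₄ (suc k))) (cong (_+ suc k) hu′)) hu′)
    E : ∀ H k U →
      (suc (suc (k + k)) * (suc (suc ((U + U) + (U + U)) + suc ((U + U) + (U + U))) + suc ((U + U) + (U + U)))
        + suc (suc ((U + U) + (U + U)) + suc ((U + U) + (U + U))) + 1) + 24 * (H + U)
      ≡ (2 * (10 * U + 3) + 2 * (((4 * H + k + 4 * U) + suc k) + (4 * H + k + 4 * U) + suc ((U + U) + (U + U)))
          + 2 * (4 * H + k + 4 * U) + suc ((U + U) + (U + U))) + 1 + 24 * (k * U)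
    E = solve-∀
    goal : 2 * (10 * U + 3) + 2 * harper (suc (u′ + u′)) + 2 * harper y + y ≤ suc (suc (k + k)) * (suc (u′ + u′) + y) + suc (u′ + u′) + 1
    goal rewrite y≡ | hx | hu′ = ≤-by-cancelling _ _ _ _ (E H k U) (cong (24 *_) (proj₂ ih))

harper-inequality : ∀ m → 1 ≤ m → ∀ y → xval (suc m) + y ≡ 2 ^ m →
  2 * bound (suc m) + 2 * harper (xval (suc m)) + 2 * harper y + y ≤ m * (xval (suc m) + y) + xval (suc m) + 1
harper-inequality (suc m) _ with even⊎odd m
... | inj₁ (k , refl) = harper-inequality-even k
... | inj₂ (k , refl) = harper-inequality-odd k

-- Edge-isoperimetry in the hypercube

size : ∀ n → (Vertex n → Bool) → ℕ
size n P = sumV n (𝟙 ∘ P)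

slice : ∀ {m} → Fin (suc m) → Bool → (Vertex (suc m) → Bool) → Vertex m → Bool
slice i b P v = P (insertAt v i b)

innerEdges : ∀ n → (Vertex n → Bool) → ℕ
innerEdges zero    P = 0
innerEdges (suc m) P = innerEdges m (slice fz false P) + innerEdges m (slice fz true P)
                     + size m (λ v → slice fz false P v ∧ slice fz true P v)

boundary : ∀ n → (Vertex n → Bool) → ℕ
boundary zero    P = 0
boundary (suc m) P = boundary m (slice fz false P) + boundary m (slice fz true P)
                   + size m (λ v → slice fz false P v xor slice fz true P v)

sumV-slices : ∀ m (i : Fin (suc m)) (F : Vertex (suc m) → ℕ) →
  sumV (suc m) F ≡ sumV m (λ v → F (insertAt v i false)) + sumV m (λ v → F (insertAt v i true))
sumV-slices m       fz     F = refl
sumV-slices (suc m) (fs i) F =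
  trans (cong₂ _+_ (sumV-slices m i (F ∘ (false ∷_))) (sumV-slices m i (F ∘ (true ∷_))))
        (interchange (sumV m (λ v → F (false ∷ insertAt v i false))) (sumV m (λ v → F (false ∷ insertAt v i true)))
                     (sumV m (λ v → F (true ∷ insertAt v i false))) (sumV m (λ v → F (true ∷ insertAt v i true))))

size-slices : ∀ m (i : Fin (suc m)) b (P : Vertex (suc m) → Bool) →
  size (suc m) P ≡ size m (slice i b P) + size m (slice i (not b) P)
size-slices m i false P = sumV-slices m i (𝟙 ∘ P)
size-slices m i true  P = trans (sumV-slices m i (𝟙 ∘ P)) (+-comm (size m (slice i false P)) _)

boundary-slices : ∀ m (i : Fin (suc m)) (P : Vertex (suc m) → Bool) →
  boundary (suc m) P ≡ boundary m (slice i false P) + boundary m (slice i true P)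
                     + size m (λ v → slice i false P v xor slice i true P v)
boundary-slices m       fz     P = refl
boundary-slices (suc m) (fs i) P =
  trans (cong₂ _+_ (cong₂ _+_ (boundary-slices m i (slice fz false P)) (boundary-slices m i (slice fz true P)))
                   (sumV-slices m i (λ w → 𝟙 (P (false ∷ w) xor P (true ∷ w)))))
        (regroup (boundary m (slice i false Q₀)) (boundary m (slice i true Q₀)) (across Q₀)
                 (boundary m (slice i false Q₁)) (boundary m (slice i true Q₁)) (across Q₁)
                 (size m (λ v → slice i false Q₀ v xor slice i false Q₁ v))
                 (size m (λ v → slice i true Q₀ v xor slice i true Q₁ v)))
  where
  Q₀ = slice fz false P
  Q₁ = slice fz true P
  across : (Vertex (suc m) → Bool) → ℕ
  across Q = size m (λ v → slice i false Q v xor slice i true Q v)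
  regroup : ∀ a₀₀ a₀₁ x₀ a₁₀ a₁₁ x₁ s₀ s₁ →
    (a₀₀ + a₀₁ + x₀) + (a₁₀ + a₁₁ + x₁) + (s₀ + s₁) ≡ (a₀₀ + a₁₀ + s₀) + (a₀₁ + a₁₁ + s₁) + (x₀ + x₁)
  regroup = solve-∀

𝟙-split : ∀ p q → 𝟙 p + 𝟙 q ≡ (𝟙 (p ∧ q) + 𝟙 (p ∧ q)) + 𝟙 (p xor q)
𝟙-split false false = refl
𝟙-split false true  = refl
𝟙-split true  false = refl
𝟙-split true  true  = refl

𝟙-∧ˡ : ∀ p q → 𝟙 (p ∧ q) ≤ 𝟙 p
𝟙-∧ˡ false q     = z≤n
𝟙-∧ˡ true  false = z≤n
𝟙-∧ˡ true  true  = ≤-refl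

𝟙-∧ʳ : ∀ p q → 𝟙 (p ∧ q) ≤ 𝟙 q
𝟙-∧ʳ false q     = z≤n
𝟙-∧ʳ true  false = ≤-refl
𝟙-∧ʳ true  true  = ≤-refl

𝟙-xorˡ : ∀ p q → 𝟙 p ≤ 𝟙 q + 𝟙 (p xor q)
𝟙-xorˡ false q     = z≤n
𝟙-xorˡ true  false = ≤-refl
𝟙-xorˡ true  true  = s≤s z≤n

𝟙-xorʳ : ∀ p q → 𝟙 q ≤ 𝟙 p + 𝟙 (p xor q)
𝟙-xorʳ p     false = z≤n
𝟙-xorʳ false true  = ≤-refl
𝟙-xorʳ true  true  = s≤s z≤n

size-split : ∀ m (P Q : Vertex m → Bool) →
  size m P + size m Q ≡ (size m (λ v → P v ∧ Q v) + size m (λ v → P v ∧ Q v)) + size m (λ v → P v xor Q v)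
size-split m P Q = begin
  size m P + size m Q                                        ≡⟨ sumV-+ m _ _ ⟨
  sumV m (λ v → 𝟙 (P v) + 𝟙 (Q v))                           ≡⟨ sumV-cong m (λ v → 𝟙-split (P v) (Q v)) ⟩
  sumV m (λ v → (𝟙 (P v ∧ Q v) + 𝟙 (P v ∧ Q v)) + 𝟙 (P v xor Q v))
    ≡⟨ sumV-+ m _ _ ⟩
  sumV m (λ v → 𝟙 (P v ∧ Q v) + 𝟙 (P v ∧ Q v)) + size m (λ v → P v xor Q v)
    ≡⟨ cong (_+ size m (λ v → P v xor Q v)) (sumV-+ m _ _) ⟩
  (size m (λ v → P v ∧ Q v) + size m (λ v → P v ∧ Q v)) + size m (λ v → P v xor Q v) ∎
  where open ≡-Reasoning

-- Every vertex of P has degree m; each inner edge is counted twice, each boundary edge once.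
degree-sum : ∀ m P → m * size m P ≡ (innerEdges m P + innerEdges m P) + boundary m P
degree-sum zero    P = refl
degree-sum (suc m) P = begin
  suc m * (a + b)                                            ≡⟨ expand m a b ⟩
  (a + b) + (m * a + m * b)
    ≡⟨ cong₂ _+_ (size-split m P₀ P₁) (cong₂ _+_ (degree-sum m P₀) (degree-sum m P₁)) ⟩
  ((s∧ + s∧) + sx) + (((e₀ + e₀) + d₀) + ((e₁ + e₁) + d₁))  ≡⟨ regroup s∧ sx e₀ e₁ d₀ d₁ ⟩
  ((e₀ + e₁ + s∧) + (e₀ + e₁ + s∧)) + (d₀ + d₁ + sx)         ∎
  where
  open ≡-Reasoning
  P₀ = slice fz false P
  P₁ = slice fz true P
  a = size m P₀
  b = size m P₁
  s∧ = size m (λ v → P₀ v ∧ P₁ v)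
  sx = size m (λ v → P₀ v xor P₁ v)
  e₀ = innerEdges m P₀
  e₁ = innerEdges m P₁
  d₀ = boundary m P₀
  d₁ = boundary m P₁
  expand : ∀ m a b → suc m * (a + b) ≡ (a + b) + (m * a + m * b)
  expand = solve-∀
  regroup : ∀ s∧ sx e₀ e₁ d₀ d₁ →
    ((s∧ + s∧) + sx) + (((e₀ + e₀) + d₀) + ((e₁ + e₁) + d₁)) ≡ ((e₀ + e₁ + s∧) + (e₀ + e₁ + s∧)) + (d₀ + d₁ + sx)
  regroup = solve-∀

innerEdges≤harper : ∀ m P → innerEdges m P ≤ harper (size m P)
innerEdges≤harper zero    P = z≤n
innerEdges≤harper (suc m) P =
  ≤-trans (+-monoˡ-≤ _ (+-mono-≤ (innerEdges≤harper m P₀) (innerEdges≤harper m P₁)))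
          (harper-superadditive (size m P₀) (size m P₁) _
            (sumV-mono m (λ v → 𝟙-∧ˡ (P₀ v) (P₁ v))) (sumV-mono m (λ v → 𝟙-∧ʳ (P₀ v) (P₁ v))))
  where
  P₀ = slice fz false P
  P₁ = slice fz true P

edge-isoperimetry : ∀ m P → m * size m P ≤ (harper (size m P) + harper (size m P)) + boundary m P
edge-isoperimetry m P = ≤-trans (≤-reflexive (degree-sum m P))
  (+-monoˡ-≤ (boundary m P) (+-mono-≤ (innerEdges≤harper m P) (innerEdges≤harper m P)))

private
  combine : ∀ m x y hx hy bx by X → m * x ≤ (hx + hx) + bx → m * y ≤ (hy + hy) + by → x ≤ y + X →
    m * (x + y) + x ≤ (bx + by + X) + ((hx + hx) + (hy + hy) + y)
  combine m x y hx hy bx by X isoˣ isoʸ x≤ = begin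
    m * (x + y) + x                                ≡⟨ cong (_+ x) (*-distribˡ-+ m x y) ⟩
    m * x + m * y + x                              ≤⟨ +-mono-≤ (+-mono-≤ isoˣ isoʸ) x≤ ⟩
    ((hx + hx) + bx) + ((hy + hy) + by) + (y + X)  ≡⟨ regroup hx hy bx by y X ⟩
    (bx + by + X) + ((hx + hx) + (hy + hy) + y)    ∎
    where
    open ≤-Reasoning
    regroup : ∀ hx hy bx by y X →
      ((hx + hx) + bx) + ((hy + hy) + by) + (y + X) ≡ (bx + by + X) + ((hx + hx) + (hy + hy) + y)
    regroup = solve-∀

-- Edge-isoperimetry in both halves of Q_(m+1) cut along coordinate i, plus the edges between
-- the halves, which are at least the difference of the sizes of the two halves.
boundary-lower-bound : ∀ m (i : Fin (suc m)) b (P : Vertex (suc m) → Bool) →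
  m * (size m (slice i b P) + size m (slice i (not b) P)) + size m (slice i b P)
    ≤ boundary (suc m) P + ((harper (size m (slice i b P)) + harper (size m (slice i b P)))
                          + (harper (size m (slice i (not b) P)) + harper (size m (slice i (not b) P)))
                          + size m (slice i (not b) P))
boundary-lower-bound m i false P rewrite boundary-slices m i P =
  combine m (size m P₀) (size m P₁) (harper (size m P₀)) (harper (size m P₁)) (boundary m P₀) (boundary m P₁) (size m P₀∆P₁)
    (edge-isoperimetry m P₀) (edge-isoperimetry m P₁)
    (≤-trans (sumV-mono m (λ v → 𝟙-xorˡ (P₀ v) (P₁ v))) (≤-reflexive (sumV-+ m (𝟙 ∘ P₁) (𝟙 ∘ P₀∆P₁))))
  where
  P₀ = slice i false P
  P₁ = slice i true P
  P₀∆P₁ = λ v → P₀ v xor P₁ v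
boundary-lower-bound m i true P rewrite boundary-slices m i P | +-comm (boundary m (slice i false P)) (boundary m (slice i true P)) =
  combine m (size m P₁) (size m P₀) (harper (size m P₁)) (harper (size m P₀)) (boundary m P₁) (boundary m P₀) (size m P₀∆P₁)
    (edge-isoperimetry m P₁) (edge-isoperimetry m P₀)
    (≤-trans (sumV-mono m (λ v → 𝟙-xorʳ (P₀ v) (P₁ v))) (≤-reflexive (sumV-+ m (𝟙 ∘ P₀) (𝟙 ∘ P₀∆P₁))))
  where
  P₀ = slice i false P
  P₁ = slice i true P
  P₀∆P₁ = λ v → P₀ v xor P₁ v

size-side : ∀ m (i : Fin (suc m)) b (P : Vertex (suc m) → Bool) →
  sumV (suc m) (λ v → 𝟙 (does (lookup v i ≟ᵇ b) ∧ P v)) ≡ size m (slice i b P)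
size-side m i b P = trans (sumV-slices m i (λ v → 𝟙 (does (lookup v i ≟ᵇ b) ∧ P v)))
                          (trans (cong₂ _+_ (side false) (side true)) (pick b))
  where
  side : ∀ c → sumV m (λ w → 𝟙 (does (lookup (insertAt w i c) i ≟ᵇ b) ∧ P (insertAt w i c)))
              ≡ sumV m (λ w → 𝟙 (does (c ≟ᵇ b) ∧ slice i c P w))
  side c = sumV-cong m (λ w → cong (λ z → 𝟙 (does (z ≟ᵇ b) ∧ P (insertAt w i c))) (insertAt-lookup w i c))
  none : sumV m (λ _ → 0) ≡ 0
  none = trans (sumV-const m 0) (*-zeroʳ (2 ^ m))
  pick : ∀ b → sumV m (λ w → 𝟙 (does (false ≟ᵇ b) ∧ slice i false P w)) + sumV m (λ w → 𝟙 (does (true ≟ᵇ b) ∧ slice i true P w))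
             ≡ size m (slice i b P)
  pick false = trans (cong (size m (slice i false P) +_) none) (+-identityʳ _)
  pick true  = cong (_+ size m (slice i true P)) none

boundary-of-balanced-set : ∀ m → 1 ≤ m → (i : Fin (suc m)) (b : Bool) (P : Vertex (suc m) → Bool) →
  size (suc m) P ≡ 2 ^ m → size m (slice i b P) ≡ xval (suc m) →
  bound (suc m) + bound (suc m) ≤ boundary (suc m) P + 1
boundary-of-balanced-set m 1≤m i b P |P|≡ |Pᵇ|≡x =
  +-cancelʳ-≤ Z _ _ (begin
    (B + B) + Z                        ≡⟨ regroup B (harper x) (harper y) y ⟩
    2 * B + 2 * harper x + 2 * harper y + y ≤⟨ harper-inequality m 1≤m y x+y≡ ⟩
    m * (x + y) + x + 1                ≤⟨ +-monoˡ-≤ 1 lower ⟩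
    boundary (suc m) P + Z + 1         ≡⟨ swap-last (boundary (suc m) P) Z ⟩
    boundary (suc m) P + 1 + Z         ∎)
  where
  open ≤-Reasoning
  B = bound (suc m)
  x = xval (suc m)
  y = size m (slice i (not b) P)
  Z = (harper x + harper x) + (harper y + harper y) + y
  x+y≡ : x + y ≡ 2 ^ m
  x+y≡ = trans (cong (_+ y) (sym |Pᵇ|≡x)) (trans (sym (size-slices m i b P)) |P|≡)
  lower : m * (x + y) + x ≤ boundary (suc m) P + Z
  lower = subst (λ z → m * (z + y) + z ≤ boundary (suc m) P + ((harper z + harper z) + (harper y + harper y) + y))
                |Pᵇ|≡x (boundary-lower-bound m i b P)
  swap-last : ∀ a z → a + z + 1 ≡ a + 1 + z
  swap-last = solve-∀
  regroup : ∀ B a c y → (B + B) + ((a + a) + (c + c) + y) ≡ 2 * B + 2 * a + 2 * c + y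
  regroup = solve-∀

-- Clockwise distance on the cycle

cw-wrap : ∀ N a b → b < a → cw N a b ≡ b + N ∸ a
cw-wrap N a b b<a with b <ᵇ a | <ᵇ-reflects-< b a
... | true  | _        = refl
... | false | ofⁿ b≮a = contradiction b<a b≮a

cw-nowrap : ∀ N a b → a ≤ b → cw N a b ≡ b ∸ a
cw-nowrap N a b a≤b with b <ᵇ a | <ᵇ-reflects-< b a
... | true  | ofʸ b<a = contradiction a≤b (<⇒≱ b<a)
... | false | _       = refl

Wrap : ℕ → ℕ → ℕ → ℕ → Set
Wrap N a b d = ∃[ α ] α ≤ 1 × a + d ≡ b + α * N

cw-Wrap : ∀ N a b → a < N → b < N → Wrap N a b (cw N a b)
cw-Wrap N a b a<N b<N with b <? a
... | yes b<a rewrite cw-wrap N a b b<a =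
  1 , s≤s z≤n , trans (m+[n∸m]≡n (≤-trans (<⇒≤ a<N) (m≤n+m N b))) (cong (b +_) (sym (+-identityʳ N)))
... | no b≮a rewrite cw-nowrap N a b (≮⇒≥ b≮a) =
  0 , z≤n , trans (m+[n∸m]≡n (≮⇒≥ b≮a)) (sym (+-identityʳ b))

cw<N : ∀ N a b → a < N → b < N → cw N a b < N
cw<N N a b a<N b<N with b <? a
... | yes b<a rewrite cw-wrap N a b b<a =
  subst (b + N ∸ a <_) (m+n∸m≡n a N) (∸-monoˡ-< (+-monoˡ-< N b<a) (≤-trans (<⇒≤ a<N) (m≤n+m N b)))
... | no b≮a rewrite cw-nowrap N a b (≮⇒≥ b≮a) = ≤-<-trans (m∸n≤m b a) b<N

private
  one-wrap-more : ∀ N a b d d′ → a + d ≡ b + 0 * N → a + d′ ≡ b + 1 * N → N ≤ d′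
  one-wrap-more N a b d d′ e e′ = ≤-trans (m≤n+m N d) (≤-reflexive (sym (+-cancelˡ-≡ a d′ (d + N) (begin
    a + d′          ≡⟨ e′ ⟩
    b + 1 * N       ≡⟨ cong₂ _+_ (trans (sym (+-identityʳ b)) (sym e)) (*-identityˡ N) ⟩
    (a + d) + N     ≡⟨ +-assoc a d N ⟩
    a + (d + N)     ∎))))
    where open ≡-Reasoning

Wrap-unique : ∀ N a b d d′ → d < N → d′ < N → Wrap N a b d → Wrap N a b d′ → d ≡ d′
Wrap-unique N a b d d′ _ _ (0 , _ , e) (0 , _ , e′) = +-cancelˡ-≡ a d d′ (trans e (sym e′))
Wrap-unique N a b d d′ _ _ (1 , _ , e) (1 , _ , e′) = +-cancelˡ-≡ a d d′ (trans e (sym e′))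
Wrap-unique N a b d d′ _ d′<N (0 , _ , e) (1 , _ , e′) = contradiction (one-wrap-more N a b d d′ e e′) (<⇒≱ d′<N)
Wrap-unique N a b d d′ d<N _ (1 , _ , e) (0 , _ , e′) = contradiction (one-wrap-more N a b d′ d e′ e) (<⇒≱ d<N)
Wrap-unique N a b d d′ _ _ (suc (suc _) , s≤s () , _) _
Wrap-unique N a b d d′ _ _ (0 , _ , _) (suc (suc _) , s≤s () , _)
Wrap-unique N a b d d′ _ _ (1 , _ , _) (suc (suc _) , s≤s () , _)

cw-unique : ∀ N a b d → a < N → b < N → d < N → Wrap N a b d → cw N a b ≡ d
cw-unique N a b d a<N b<N d<N w = Wrap-unique N a b _ d (cw<N N a b a<N b<N) d<N (cw-Wrap N a b a<N b<N) w

private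
  reduce-wraps : ∀ X Y N β κ → Y < N → X < N + N → β ≤ 1 → κ ≤ 2 → X + β * N ≡ Y + κ * N →
    ∃[ α ] α ≤ 1 × X ≡ Y + α * N
  reduce-wraps X Y N 0 0 _ _ _ _ e = 0 , z≤n , trans (sym (+-identityʳ X)) e
  reduce-wraps X Y N 0 1 _ _ _ _ e = 1 , s≤s z≤n , trans (sym (+-identityʳ X)) e
  reduce-wraps X Y N 0 2 _ X<2N _ _ e = contradiction 2N≤X (<⇒≱ X<2N)
    where
    2N≤X : N + N ≤ X
    2N≤X = ≤-trans (≤-trans (≤-reflexive (cong (N +_) (sym (+-identityʳ N)))) (m≤n+m (N + (N + 0)) Y))
                   (≤-reflexive (sym (trans (sym (+-identityʳ X)) e)))
  reduce-wraps X Y N 1 0 Y<N _ _ _ e = contradiction N≤Y (<⇒≱ Y<N)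
    where
    N≤Y : N ≤ Y
    N≤Y = ≤-trans (≤-trans (≤-reflexive (sym (+-identityʳ N))) (m≤n+m (N + 0) X)) (≤-reflexive (trans e (+-identityʳ Y)))
  reduce-wraps X Y N 1 1 _ _ _ _ e = 0 , z≤n , +-cancelʳ-≡ (1 * N) X (Y + 0 * N) (trans e (cong (_+ (1 * N)) (sym (+-identityʳ Y))))
  reduce-wraps X Y N 1 2 _ _ _ _ e = 1 , s≤s z≤n , +-cancelʳ-≡ (1 * N) X (Y + 1 * N) (trans e (two-wraps Y N))
    where
    two-wraps : ∀ Y N → Y + 2 * N ≡ (Y + 1 * N) + 1 * N
    two-wraps = solve-∀
  reduce-wraps X Y N (suc (suc _)) _ _ _ (s≤s ()) _ _
  reduce-wraps X Y N 0 (suc (suc (suc _))) _ _ _ (s≤s (s≤s ())) _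
  reduce-wraps X Y N 1 (suc (suc (suc _))) _ _ _ (s≤s (s≤s ())) _

  compose-Wrap : ∀ N j a b A B D → B < N → A + D < N + N →
    Wrap N j a A → Wrap N j b B → Wrap N a b D → Wrap N A B D
  compose-Wrap N j a b A B D B<N A+D<2N (α , α≤1 , eA) (β , β≤1 , eB) (γ , γ≤1 , eD) =
    reduce-wraps (A + D) B N β (α + γ) B<N A+D<2N β≤1 (+-mono-≤ α≤1 γ≤1) (+-cancelˡ-≡ j _ _ (begin
      j + ((A + D) + β * N)        ≡⟨ E₁ j A D β N ⟩
      (j + A) + D + β * N          ≡⟨ cong (λ z → z + D + β * N) eA ⟩
      (a + α * N) + D + β * N      ≡⟨ E₂ a α N D β ⟩
      (a + D) + α * N + β * N      ≡⟨ cong (λ z → z + α * N + β * N) eD ⟩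
      (b + γ * N) + α * N + β * N  ≡⟨ E₃ b γ N α β ⟩
      (b + β * N) + (α + γ) * N    ≡⟨ cong (_+ (α + γ) * N) eB ⟨
      (j + B) + (α + γ) * N        ≡⟨ +-assoc j B _ ⟩
      j + (B + (α + γ) * N)        ∎))
    where
    open ≡-Reasoning
    E₁ : ∀ j A D β N → j + ((A + D) + β * N) ≡ (j + A) + D + β * N
    E₁ = solve-∀
    E₂ : ∀ a α N D β → (a + α * N) + D + β * N ≡ (a + D) + α * N + β * N
    E₂ = solve-∀
    E₃ : ∀ b γ N α β → (b + γ * N) + α * N + β * N ≡ (b + β * N) + (α + γ) * N
    E₃ = solve-∀

cw-rebase : ∀ N j a b → j < N → a < N → b < N → cw N a b ≡ cw N (cw N j a) (cw N j b)
cw-rebase N j a b j<N a<N b<N = sym (cw-unique N A B D A<N B<N D<N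
  (compose-Wrap N j a b A B D B<N (+-mono-< A<N D<N) (cw-Wrap N j a j<N a<N) (cw-Wrap N j b j<N b<N) (cw-Wrap N a b a<N b<N)))
  where
  A = cw N j a
  B = cw N j b
  D = cw N a b
  A<N = cw<N N j a j<N a<N
  B<N = cw<N N j b j<N b<N
  D<N = cw<N N a b a<N b<N

cw-surjective : ∀ N j t → j < N → t < N → ∃[ q ] q < N × cw N j q ≡ t
cw-surjective N j t j<N t<N with j + t <? N
... | yes j+t<N = j + t , j+t<N , cw-unique N j (j + t) t j<N j+t<N t<N (0 , z≤n , sym (+-identityʳ _))
... | no j+t≮N = q , q<N , cw-unique N j q t j<N q<N t<N (1 , s≤s z≤n , wraps)
  where
  q = j + t ∸ N
  q<N : q < N
  q<N = subst (q <_) (m+n∸m≡n N N) (∸-monoˡ-< (+-mono-< j<N t<N) (≮⇒≥ j+t≮N))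
  wraps : j + t ≡ q + 1 * N
  wraps = sym (trans (cong (q +_) (*-identityˡ N)) (m∸n+n≡m (≮⇒≥ j+t≮N)))

-- The arc of length H clockwise from q: a route leaving it (resp. entering it) clockwise passes
-- the gap after its last position (resp. the gap before its first position).
arc-exit-crosses : ∀ N H q a b g → q < N → a < N → b < N → g < N →
  cw N q a < H → H ≤ cw N q b → suc (cw N q g) ≡ H → onArc N a b g
arc-exit-crosses N H q a b g q<N a<N b<N g<N qa<H H≤qb qg≡ =
  subst₂ _<_ (sym (cw-rebase N q a g q<N a<N g<N)) (sym (cw-rebase N q a b q<N a<N b<N))
    (subst₂ _<_ (sym (cw-nowrap N (cw N q a) (cw N q g) qa≤qg)) (sym (cw-nowrap N (cw N q a) (cw N q b) (≤-trans (<⇒≤ qa<H) H≤qb)))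
      (∸-monoˡ-< (≤-trans (≤-reflexive qg≡) H≤qb) qa≤qg))
  where
  qa≤qg : cw N q a ≤ cw N q g
  qa≤qg = s≤s⁻¹ (subst (cw N q a <_) (sym qg≡) qa<H)

arc-entry-crosses : ∀ N H q a b g → q < N → a < N → b < N → g < N →
  H ≤ cw N q a → cw N q b < H → suc (cw N q g) ≡ N → onArc N a b g
arc-entry-crosses N H q a b g q<N a<N b<N g<N H≤qa qb<H qg≡ =
  subst₂ _<_ (sym (cw-rebase N q a g q<N a<N g<N)) (sym (cw-rebase N q a b q<N a<N b<N))
    (subst₂ _<_ (sym (cw-nowrap N (cw N q a) (cw N q g) qa≤qg)) (sym (cw-wrap N (cw N q a) (cw N q b) (<-≤-trans qb<H H≤qa)))
      (∸-monoˡ-< (≤-trans (≤-reflexive qg≡) (m≤n+m N (cw N q b))) qa≤qg))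
  where
  qa≤qg : cw N q a ≤ cw N q g
  qa≤qg = s≤s⁻¹ (subst (cw N q a <_) (sym qg≡) (cw<N N q a q<N a<N))

arc⇒shifted-arc : ∀ N H j q p t → H + H ≡ N → j < N → q < N → p < N → t ≤ H → cw N j q ≡ t →
  cw N q p < H → t ≤ cw N j p × cw N j p < t + H
arc⇒shifted-arc N H j q p t H+H≡N j<N q<N p<N t≤H jq≡t qp<H
  rewrite cw-rebase N j q p j<N q<N p<N | jq≡t with cw N j p <? t
... | yes d<t rewrite cw-wrap N t (cw N j p) d<t = contradiction qp<H (≤⇒≯ H≤)
  where
  d = cw N j p
  H≤ : H ≤ d + N ∸ t
  H≤ = ≤-trans (≤-trans (≤-reflexive (sym (m+n∸m≡n H H))) (∸-monoʳ-≤ (H + H) t≤H))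
               (≤-trans (≤-reflexive (cong (_∸ t) H+H≡N)) (∸-monoˡ-≤ t (m≤n+m N d)))
... | no d≮t rewrite cw-nowrap N t (cw N j p) (≮⇒≥ d≮t) =
  ≮⇒≥ d≮t , subst (_< t + H) (m+[n∸m]≡n (≮⇒≥ d≮t)) (+-monoʳ-< t qp<H)

shifted-arc⇒arc : ∀ N H j q p t → j < N → q < N → p < N → cw N j q ≡ t →
  t ≤ cw N j p → cw N j p < t + H → cw N q p < H
shifted-arc⇒arc N H j q p t j<N q<N p<N jq≡t t≤d d<t+H = begin-strict
  cw N q p                      ≡⟨ cw-rebase N j q p j<N q<N p<N ⟩
  cw N (cw N j q) (cw N j p)    ≡⟨ cong (λ z → cw N z (cw N j p)) jq≡t ⟩
  cw N t (cw N j p)             ≡⟨ cw-nowrap N t (cw N j p) t≤d ⟩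
  cw N j p ∸ t                  <⟨ ∸-monoˡ-< d<t+H t≤d ⟩
  t + H ∸ t                     ≡⟨ m+n∸m≡n t H ⟩
  H                             ∎
  where open ≤-Reasoning

gap-before : ∀ N q k → q < N → 1 ≤ k → k ≤ N → ∃[ g ] suc (cw N q (toℕ {N} g)) ≡ k
gap-before N q (suc k) q<N _ k<N with cw-surjective N q k q<N k<N
... | g , g<N , qg≡k = fromℕ< g<N , cong suc (trans (cong (cw N q) (toℕ-fromℕ< g<N)) qg≡k)

sumBelow-zero : ∀ N f → (∀ d → d < N → f d ≡ 0) → sumBelow N f ≡ 0
sumBelow-zero zero    f f≡0 = refl
sumBelow-zero (suc N) f f≡0 = cong₂ _+_ (sumBelow-zero N f (λ d d<N → f≡0 d (m<n⇒m<1+n d<N))) (f≡0 N ≤-refl)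

sumBelow-pick : ∀ N k (G : ℕ → ℕ) → k < N → sumBelow N (λ d → G d * 𝟙 (does (k ≟ d))) ≡ G k
sumBelow-pick (suc N) k G k<1+N with k ≟ N
... | yes refl = begin
  sumBelow k (λ d → G d * 𝟙 (does (k ≟ d))) + G k * 𝟙 (does (k ≟ k))
    ≡⟨ cong₂ _+_ (sumBelow-zero k _ (λ d d<k → off d (<⇒≢ d<k ∘ sym))) (cong (λ b → G k * 𝟙 b) (dec-true (k ≟ k) refl)) ⟩
  0 + G k * 1
    ≡⟨ *-identityʳ (G k) ⟩
  G k ∎
  where
  open ≡-Reasoning
  off : ∀ d → k ≢ d → G d * 𝟙 (does (k ≟ d)) ≡ 0
  off d k≢d = trans (cong (λ b → G d * 𝟙 b) (dec-false (k ≟ d) k≢d)) (*-zeroʳ (G d))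
... | no k≢N = begin
  sumBelow N (λ d → G d * 𝟙 (does (k ≟ d))) + G N * 𝟙 (does (k ≟ N))
    ≡⟨ cong (λ b → S + G N * 𝟙 b) (dec-false (k ≟ N) k≢N) ⟩
  S + G N * 0
    ≡⟨ trans (cong (S +_) (*-zeroʳ (G N))) (+-identityʳ S) ⟩
  S
    ≡⟨ sumBelow-pick N k G (≤∧≢⇒< (s≤s⁻¹ k<1+N) k≢N) ⟩
  G k ∎
  where
  open ≡-Reasoning
  S = sumBelow N (λ d → G d * 𝟙 (does (k ≟ d)))

N≤sumBelow : ∀ N c → (∀ d → d < N → 1 ≤ c d) → N ≤ sumBelow N c
N≤sumBelow zero    c pos = z≤n
N≤sumBelow (suc N) c pos =
  subst (_≤ sumBelow N c + c N) (+-comm N 1) (+-mono-≤ (N≤sumBelow N c (λ d d<N → pos d (m<n⇒m<1+n d<N))) (pos N ≤-refl))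

sumBelow-tight : ∀ N c → (∀ d → d < N → 1 ≤ c d) → sumBelow N c ≤ N → ∀ d → d < N → c d ≡ 1
sumBelow-tight (suc N) c pos sum≤ d d<1+N with d ≟ N
... | yes refl = ≤-antisym last≤1 (pos d ≤-refl)
  where
  last≤1 : c d ≤ 1
  last≤1 = +-cancelˡ-≤ d (c d) 1
    (≤-trans (+-monoˡ-≤ (c d) (N≤sumBelow d c (λ e e<d → pos e (m<n⇒m<1+n e<d))))
             (subst (sumBelow d c + c d ≤_) (+-comm 1 d) sum≤))
... | no d≢N = sumBelow-tight N c (λ e e<N → pos e (m<n⇒m<1+n e<N)) rest≤ d (≤∧≢⇒< (s≤s⁻¹ d<1+N) d≢N)
  where
  rest≤ : sumBelow N c ≤ N
  rest≤ = +-cancelʳ-≤ 1 (sumBelow N c) N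
    (≤-trans (+-monoʳ-≤ (sumBelow N c) (pos N ≤-refl)) (subst (sumBelow N c + c N ≤_) (+-comm 1 N) sum≤))

module Positions {n} (φ : Vertex n → ℕ) (φ<2ⁿ : ∀ v → φ v < 2 ^ n) (onto : ∀ d → d < 2 ^ n → ∃[ v ] φ v ≡ d) where

  fiber : ℕ → ℕ
  fiber d = sumV n (λ v → 𝟙 (does (φ v ≟ d)))

  private
    fibers-sum : sumBelow (2 ^ n) fiber ≡ 2 ^ n
    fibers-sum = begin
      sumBelow (2 ^ n) fiber                                  ≡⟨ sumV-sumBelow-swap n (2 ^ n) _ ⟨
      sumV n (λ v → sumBelow (2 ^ n) (λ d → 𝟙 (does (φ v ≟ d)))) ≡⟨ sumV-cong n one-position ⟩
      sumV n (λ _ → 1)                                        ≡⟨ sumV-const n 1 ⟩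
      2 ^ n * 1                                               ≡⟨ *-identityʳ (2 ^ n) ⟩
      2 ^ n                                                   ∎
      where
      open ≡-Reasoning
      one-position : ∀ v → sumBelow (2 ^ n) (λ d → 𝟙 (does (φ v ≟ d))) ≡ 1
      one-position v = trans (sumBelow-cong (2 ^ n) (λ d _ → sym (*-identityˡ _))) (sumBelow-pick (2 ^ n) (φ v) (λ _ → 1) (φ<2ⁿ v))

    fiber-nonempty : ∀ d → d < 2 ^ n → 1 ≤ fiber d
    fiber-nonempty d d<2ⁿ with onto d d<2ⁿ
    ... | v , refl = ≤-trans (≤-reflexive (sym (cong 𝟙 (dec-true (φ v ≟ φ v) refl)))) (sumV-term n (λ w → 𝟙 (does (φ w ≟ φ v))) v)

  fiber≡1 : ∀ d → d < 2 ^ n → fiber d ≡ 1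
  fiber≡1 = sumBelow-tight (2 ^ n) fiber fiber-nonempty (≤-reflexive fibers-sum)

  sumV-reindex : ∀ (G : ℕ → ℕ) → sumV n (G ∘ φ) ≡ sumBelow (2 ^ n) G
  sumV-reindex G = begin
    sumV n (G ∘ φ)                                                  ≡⟨ sumV-cong n (λ v → sym (sumBelow-pick (2 ^ n) (φ v) G (φ<2ⁿ v))) ⟩
    sumV n (λ v → sumBelow (2 ^ n) (λ d → G d * 𝟙 (does (φ v ≟ d)))) ≡⟨ sumV-sumBelow-swap n (2 ^ n) _ ⟩
    sumBelow (2 ^ n) (λ d → sumV n (λ v → G d * 𝟙 (does (φ v ≟ d)))) ≡⟨ sumBelow-cong (2 ^ n) (λ d d<2ⁿ → trans (sumV-* n (G d) _) (trans (cong (G d *_) (fiber≡1 d d<2ⁿ)) (*-identityʳ (G d)))) ⟩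
    sumBelow (2 ^ n) G                                              ∎
    where open ≡-Reasoning

discrete-ivt : ∀ (c : ℕ → ℕ) x K → x ≤ c 0 → c K ≤ x → (∀ t → t < K → c t ≤ suc (c (suc t))) →
  ∃[ t ] t ≤ K × c t ≡ x
discrete-ivt c x zero    x≤c₀ cK≤x _    = 0 , z≤n , ≤-antisym cK≤x x≤c₀
discrete-ivt c x (suc K) x≤c₀ cK≤x step with c 0 ≟ x
... | yes c₀≡x = 0 , z≤n , c₀≡x
... | no c₀≢x with discrete-ivt (c ∘ suc) x K x≤c₁ cK≤x (λ t t<K → step (suc t) (s≤s t<K))
  where
  x≤c₁ : x ≤ c 1
  x≤c₁ = s≤s⁻¹ (≤-trans (≤∧≢⇒< x≤c₀ (c₀≢x ∘ sym)) (step 0 (s≤s z≤n)))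
...   | t , t≤K , cₜ≡x = suc t , s≤s t≤K , cₜ≡x

<ᵇ-true : ∀ {m n} → m < n → (m <ᵇ n) ≡ true
<ᵇ-true {m} {n} m<n with m <ᵇ n | <ᵇ-reflects-< m n
... | true  | _        = refl
... | false | ofⁿ m≮n = contradiction m<n m≮n

≤ᵇ-true : ∀ {m n} → m ≤ n → (m ≤ᵇ n) ≡ true
≤ᵇ-true {m} {n} m≤n with m ≤ᵇ n | ≤ᵇ-reflects-≤ m n
... | true  | _        = refl
... | false | ofⁿ m≰n = contradiction m≤n m≰n

inWindow : ℕ → ℕ → ℕ → Bool
inWindow H t d = (t ≤ᵇ d) ∧ (d <ᵇ t + H)

inWindow⇒ : ∀ H t d → inWindow H t d ≡ true → t ≤ d × d < t + H
inWindow⇒ H t d eq with t ≤ᵇ d | ≤ᵇ-reflects-≤ t d | d <ᵇ t + H | <ᵇ-reflects-< d (t + H) | eq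
... | true | ofʸ t≤d | true | ofʸ d<t+H | _ = t≤d , d<t+H
... | true | _       | false | _         | ()
... | false | _      | _     | _         | ()

inWindow⇐ : ∀ H t d → t ≤ d → d < t + H → inWindow H t d ≡ true
inWindow⇐ H t d t≤d d<t+H rewrite ≤ᵇ-true t≤d | <ᵇ-true d<t+H = refl

𝟙-below-split : ∀ H t d → 𝟙 (d <ᵇ t + H) ≡ 𝟙 (d <ᵇ t) + 𝟙 (inWindow H t d)
𝟙-below-split H t d with d <ᵇ t | <ᵇ-reflects-< d t | t ≤ᵇ d | ≤ᵇ-reflects-≤ t d
... | true  | ofʸ d<t | true  | ofʸ t≤d = contradiction t≤d (<⇒≱ d<t)
... | true  | ofʸ d<t | false | _       rewrite <ᵇ-true (<-≤-trans d<t (m≤m+n t H)) = refl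
... | false | _       | true  | _       = refl
... | false | ofⁿ d≮t | false | ofⁿ t≰d = contradiction (≰⇒> t≰d) d≮t

count-below : ∀ N a → sumBelow N (λ d → 𝟙 (d <ᵇ a)) ≡ N ⊓ a
count-below zero    a = refl
count-below (suc N) a with N <ᵇ a | <ᵇ-reflects-< N a
... | true  | ofʸ N<a = begin
  sumBelow N (λ d → 𝟙 (d <ᵇ a)) + 1 ≡⟨ cong (_+ 1) (trans (count-below N a) (m≤n⇒m⊓n≡m (<⇒≤ N<a))) ⟩
  N + 1                              ≡⟨ +-comm N 1 ⟩
  suc N                              ≡⟨ m≤n⇒m⊓n≡m N<a ⟨
  suc N ⊓ a                          ∎
  where open ≡-Reasoning
... | false | ofⁿ N≮a = begin
  sumBelow N (λ d → 𝟙 (d <ᵇ a)) + 0 ≡⟨ +-identityʳ _ ⟩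
  sumBelow N (λ d → 𝟙 (d <ᵇ a))     ≡⟨ trans (count-below N a) (m≥n⇒m⊓n≡n (≮⇒≥ N≮a)) ⟩
  a                                  ≡⟨ m≥n⇒m⊓n≡n (≤-trans (≮⇒≥ N≮a) (n≤1+n N)) ⟨
  suc N ⊓ a                          ∎
  where open ≡-Reasoning

window-size : ∀ N H t → t + H ≤ N → sumBelow N (λ d → 𝟙 (inWindow H t d)) ≡ H
window-size N H t t+H≤N = +-cancelˡ-≡ t _ _ (begin
  t + sumBelow N (λ d → 𝟙 (inWindow H t d))
    ≡⟨ cong (_+ sumBelow N (λ d → 𝟙 (inWindow H t d))) (trans (count-below N t) (m≥n⇒m⊓n≡n (≤-trans (m≤m+n t H) t+H≤N))) ⟨
  sumBelow N (λ d → 𝟙 (d <ᵇ t)) + sumBelow N (λ d → 𝟙 (inWindow H t d))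
    ≡⟨ sumBelow-+ N _ _ ⟨
  sumBelow N (λ d → 𝟙 (d <ᵇ t) + 𝟙 (inWindow H t d))
    ≡⟨ sumBelow-cong N (λ d _ → sym (𝟙-below-split H t d)) ⟩
  sumBelow N (λ d → 𝟙 (d <ᵇ t + H))
    ≡⟨ trans (count-below N (t + H)) (m≥n⇒m⊓n≡n t+H≤N) ⟩
  t + H ∎)
  where open ≡-Reasoning

inWindow-step : ∀ H t d → 𝟙 (inWindow H t d) ≤ 𝟙 (inWindow H (suc t) d) + 𝟙 (does (d ≟ t))
inWindow-step H t d with inWindow H t d in eq | d ≟ t
... | false | _        = z≤n
... | true  | yes d≡t rewrite dec-true (d ≟ t) d≡t = m≤n+m 1 (𝟙 (inWindow H (suc t) d))
... | true  | no d≢t   = ≤-trans (≤-reflexive (cong 𝟙 (sym moved-in))) (m≤m+n _ (𝟙 (does (d ≟ t))))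
  where
  t≤d = proj₁ (inWindow⇒ H t d eq)
  d<t+H = proj₂ (inWindow⇒ H t d eq)
  moved-in : inWindow H (suc t) d ≡ true
  moved-in = inWindow⇐ H (suc t) d (≤∧≢⇒< t≤d (d≢t ∘ sym)) (m<n⇒m<1+n d<t+H)

inWindow-halves : ∀ H d → d < H + H → 𝟙 (inWindow H 0 d) + 𝟙 (inWindow H H d) ≡ 1
inWindow-halves H d d<2H with d <ᵇ H | <ᵇ-reflects-< d H | H ≤ᵇ d | ≤ᵇ-reflects-≤ H d
... | true  | ofʸ d<H | true  | ofʸ H≤d = contradiction H≤d (<⇒≱ d<H)
... | true  | _       | false | _       = refl
... | false | _       | true  | _       rewrite <ᵇ-true d<2H = refl
... | false | ofⁿ d≮H | false | ofⁿ H≰d = contradiction (≰⇒> H≰d) d≮H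

crossingEdges : ∀ n → (Vertex n → Bool) → ℕ
crossingEdges n P = sumV n (λ v → sumFin n (λ i → 𝟙 (not (lookup v i) ∧ (P v xor P (flip v i)))))

boundary≡crossingEdges : ∀ n P → boundary n P ≡ crossingEdges n P
boundary≡crossingEdges zero    P = refl
boundary≡crossingEdges (suc m) P = begin
  boundary m P₀ + boundary m P₁ + across
    ≡⟨ cong₂ (λ p q → p + q + across) (boundary≡crossingEdges m P₀) (boundary≡crossingEdges m P₁) ⟩
  crossingEdges m P₀ + crossingEdges m P₁ + across
    ≡⟨ trans (+-comm _ across) (sym (+-assoc across _ _)) ⟩
  (across + crossingEdges m P₀) + crossingEdges m P₁
    ≡⟨ cong (_+ crossingEdges m P₁) (sumV-+ m (λ v → 𝟙 (P₀ v xor P₁ v)) _) ⟨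
  crossingEdges (suc m) P ∎
  where
  open ≡-Reasoning
  P₀ = slice fz false P
  P₁ = slice fz true P
  across = size m (λ v → P₀ v xor P₁ v)

routed : ∀ {n} → Embedding n → Routing n → Fin (2 ^ n) → Vertex n × Fin n → ℕ
routed η ρ g e = 𝟙 (does (isEdge? e ×-dec passes? η ρ g e))

cut≡sumV : ∀ {n} (η : Embedding n) ρ g → cut η ρ g ≡ sumV n (λ v → sumFin n (λ i → routed η ρ g (v , i)))
cut≡sumV {n} η ρ g = begin
  cut η ρ g                                                     ≡⟨ count≡sumList _ (cartesianProduct (allVertices n) (allFin n)) ⟩
  sumList (routed η ρ g) (cartesianProduct (allVertices n) (allFin n))
    ≡⟨ sumList-cartesianProduct (routed η ρ g) (allVertices n) (allFin n) ⟩
  sumList (λ v → sumList (λ i → routed η ρ g (v , i)) (allFin n)) (allVertices n)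
    ≡⟨ sumList-allVertices n _ ⟩
  sumV n (λ v → sumList (λ i → routed η ρ g (v , i)) (allFin n))
    ≡⟨ sumV-cong n (λ v → sumList-allFin n (λ i → routed η ρ g (v , i))) ⟩
  sumV n (λ v → sumFin n (λ i → routed η ρ g (v , i))) ∎
  where
  open ≡-Reasoning

pos : ∀ {n} → Embedding n → Vertex n → ℕ
pos η v = toℕ (Bijection.to η v)

-- S is an arc of H consecutive positions starting at q; g₁ and g₂ are the gaps at its two ends.
module ArcCuts {n} (η : Embedding n) (ρ : Routing n) (S : Vertex n → Bool) (H q : ℕ) (g₁ g₂ : Fin (2 ^ n))
  (q<2ⁿ : q < 2 ^ n)
  (S⇒in : ∀ v → S v ≡ true → cw (2 ^ n) q (pos η v) < H)
  (¬S⇒out : ∀ v → S v ≡ false → H ≤ cw (2 ^ n) q (pos η v))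
  (g₁-end : suc (cw (2 ^ n) q (toℕ g₁)) ≡ H)
  (g₂-end : suc (cw (2 ^ n) q (toℕ g₂)) ≡ 2 ^ n) where

  private
    pos<2ⁿ : ∀ v → pos η v < 2 ^ n
    pos<2ⁿ v = toℕ<n (Bijection.to η v)

    exit : ∀ v w → S v ≡ true → S w ≡ false → onArc (2 ^ n) (pos η v) (pos η w) (toℕ g₁)
    exit v w v∈S w∉S = arc-exit-crosses (2 ^ n) H q _ _ _ q<2ⁿ (pos<2ⁿ v) (pos<2ⁿ w) (toℕ<n g₁) (S⇒in v v∈S) (¬S⇒out w w∉S) g₁-end

    entry : ∀ v w → S v ≡ false → S w ≡ true → onArc (2 ^ n) (pos η v) (pos η w) (toℕ g₂)
    entry v w v∉S w∈S = arc-entry-crosses (2 ^ n) H q _ _ _ q<2ⁿ (pos<2ⁿ v) (pos<2ⁿ w) (toℕ<n g₂) (¬S⇒out v v∉S) (S⇒in w w∈S) g₂-end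

    first : ∀ {x y} z → x < y → 1 ≤ 𝟙 (x <ᵇ y) + z
    first z x<y rewrite <ᵇ-true x<y = s≤s z≤n

    second : ∀ {x y} z → x < y → 1 ≤ z + 𝟙 (x <ᵇ y)
    second z x<y rewrite <ᵇ-true x<y | +-comm z 1 = s≤s z≤n

  crossing≤routed : ∀ v i → 𝟙 (not (lookup v i) ∧ (S v xor S (flip v i))) ≤ routed η ρ g₁ (v , i) + routed η ρ g₂ (v , i)
  crossing≤routed v i with lookup v i
  ... | true  = z≤n
  ... | false with S v in v∈S | S (flip v i) in w∈S | ρ v i
  ...   | true  | true  | _     = z≤n
  ...   | false | false | _     = z≤n
  ...   | true  | false | true  = first _ (exit v (flip v i) v∈S w∈S)
  ...   | true  | false | false = second _ (entry (flip v i) v w∈S v∈S)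
  ...   | false | true  | true  = second _ (entry v (flip v i) v∈S w∈S)
  ...   | false | true  | false = first _ (exit (flip v i) v w∈S v∈S)

  boundary≤cuts : boundary n S ≤ cut η ρ g₁ + cut η ρ g₂
  boundary≤cuts = begin
    boundary n S
      ≡⟨ boundary≡crossingEdges n S ⟩
    crossingEdges n S
      ≤⟨ sumV-mono n (λ v → sumFin-mono n (crossing≤routed v)) ⟩
    sumV n (λ v → sumFin n (λ i → R₁ (v , i) + R₂ (v , i)))
      ≡⟨ sumV-cong n (λ v → sumFin-+ n _ _) ⟩
    sumV n (λ v → sumFin n (λ i → R₁ (v , i)) + sumFin n (λ i → R₂ (v , i)))
      ≡⟨ sumV-+ n _ _ ⟩
    sumV n (λ v → sumFin n (λ i → R₁ (v , i))) + sumV n (λ v → sumFin n (λ i → R₂ (v , i)))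
      ≡⟨ cong₂ _+_ (cut≡sumV η ρ g₁) (cut≡sumV η ρ g₂) ⟨
    cut η ρ g₁ + cut η ρ g₂ ∎
    where
    open ≤-Reasoning
    R₁ = routed η ρ g₁
    R₂ = routed η ρ g₂

one-of-two-exceeds : ∀ {A : Set} (f : A → ℕ) g₁ g₂ B X → B + B ≤ X + 1 → X ≤ f g₁ + f g₂ → ∃[ g ] B ≤ f g
one-of-two-exceeds f g₁ g₂ B X 2B≤X+1 X≤ with B ≤? f g₁
... | yes B≤f₁ = g₁ , B≤f₁
... | no B≰f₁ = g₂ , +-cancelˡ-≤ B B (f g₂) (begin
  B + B               ≤⟨ 2B≤X+1 ⟩
  X + 1               ≤⟨ +-monoˡ-≤ 1 X≤ ⟩
  f g₁ + f g₂ + 1     ≡⟨ +-comm _ 1 ⟩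
  suc (f g₁) + f g₂   ≤⟨ +-monoˡ-≤ (f g₂) (≰⇒> B≰f₁) ⟩
  B + f g₂            ∎)
  where open ≤-Reasoning

-- Arcs of 2 ^ m consecutive positions, located by their clockwise offset from position j.
module ArcSweep {m : ℕ} (η : Embedding (suc m)) (i : Fin (suc m)) (b : Bool) (j : Fin (2 ^ suc m)) where

  private
    N = 2 ^ suc m
    H = 2 ^ m

    H+H≡N : H + H ≡ N
    H+H≡N = cong (H +_) (sym (+-identityʳ H))

    H<N : H < N
    H<N = subst (H <_) H+H≡N (m<m+n H (m^n>0 2 m))

    pos<N : ∀ v → pos η v < N
    pos<N v = toℕ<n (Bijection.to η v)

  offset : Vertex (suc m) → ℕ
  offset v = cw N (toℕ j) (pos η v)

  private
    offset<N : ∀ v → offset v < N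
    offset<N v = cw<N N (toℕ j) (pos η v) (toℕ<n j) (pos<N v)

    offset-onto : ∀ d → d < N → ∃[ v ] offset v ≡ d
    offset-onto d d<N with cw-surjective N (toℕ j) d (toℕ<n j) d<N
    ... | q , q<N , jq≡d with Bijection.strictlySurjective η (fromℕ< q<N)
    ...   | v , v↦q = v , trans (cong (cw N (toℕ j)) (trans (cong toℕ v↦q) (toℕ-fromℕ< q<N))) jq≡d

  open Positions offset offset<N offset-onto

  arc : ℕ → Vertex (suc m) → Bool
  arc t v = inWindow H t (offset v)

  onSide : Vertex (suc m) → Bool
  onSide v = does (lookup v i ≟ᵇ b)

  sideCount : ℕ → ℕ
  sideCount t = sumV (suc m) (λ v → 𝟙 (onSide v ∧ arc t v))

  inArcCount≡sideCount : inArcCount η i b j ≡ sideCount 0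
  inArcCount≡sideCount = trans (count≡sumList _ (allVertices (suc m))) (sumList-allVertices (suc m) _)

  sideCount≡size : ∀ t → sideCount t ≡ size m (slice i b (arc t))
  sideCount≡size t = size-side m i b (arc t)

  arc-size : ∀ t → t ≤ H → size (suc m) (arc t) ≡ H
  arc-size t t≤H = trans (sumV-reindex (𝟙 ∘ inWindow H t)) (window-size N H t (≤-trans (+-monoˡ-≤ H t≤H) (≤-reflexive H+H≡N)))

  private
    sideCount-step : ∀ t → t < N → sideCount t ≤ suc (sideCount (suc t))
    sideCount-step t t<N = begin
      sideCount t
        ≤⟨ sumV-mono (suc m) step ⟩
      sumV (suc m) (λ v → 𝟙 (onSide v ∧ arc (suc t) v) + 𝟙 (does (offset v ≟ t)))
        ≡⟨ sumV-+ (suc m) (λ v → 𝟙 (onSide v ∧ arc (suc t) v)) (λ v → 𝟙 (does (offset v ≟ t))) ⟩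
      sideCount (suc t) + fiber t
        ≡⟨ cong (sideCount (suc t) +_) (fiber≡1 t t<N) ⟩
      sideCount (suc t) + 1
        ≡⟨ +-comm _ 1 ⟩
      suc (sideCount (suc t)) ∎
      where
      open ≤-Reasoning
      step : ∀ v → 𝟙 (onSide v ∧ arc t v) ≤ 𝟙 (onSide v ∧ arc (suc t) v) + 𝟙 (does (offset v ≟ t))
      step v with onSide v
      ... | true  = inWindow-step H t (offset v)
      ... | false = z≤n

    sideCount-halves : sideCount 0 + sideCount H ≡ H
    sideCount-halves = begin
      sideCount 0 + sideCount H                      ≡⟨ sumV-+ (suc m) (λ v → 𝟙 (onSide v ∧ arc 0 v)) (λ v → 𝟙 (onSide v ∧ arc H v)) ⟨
      sumV (suc m) (λ v → 𝟙 (onSide v ∧ arc 0 v) + 𝟙 (onSide v ∧ arc H v)) ≡⟨ sumV-cong (suc m) halves ⟩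
      sumV (suc m) (λ v → 𝟙 (onSide v ∧ true))      ≡⟨ size-side m i b (λ _ → true) ⟩
      sumV m (λ _ → 1)                               ≡⟨ trans (sumV-const m 1) (*-identityʳ H) ⟩
      H                                              ∎
      where
      open ≡-Reasoning
      halves : ∀ v → 𝟙 (onSide v ∧ arc 0 v) + 𝟙 (onSide v ∧ arc H v) ≡ 𝟙 (onSide v ∧ true)
      halves v with onSide v
      ... | true  = inWindow-halves H (offset v) (subst (offset v <_) (sym H+H≡N) (offset<N v))
      ... | false = refl

  balanced-arc : 1 ≤ m → xval (suc m) ≤ sideCount 0 → ∃[ t ] t ≤ H × sideCount t ≡ xval (suc m)
  balanced-arc 1≤m x≤c₀ = discrete-ivt sideCount x H x≤c₀ cH≤x (λ t t<H → sideCount-step t (<-trans t<H H<N))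
    where
    x = xval (suc m)
    cH≤x : sideCount H ≤ x
    cH≤x = +-cancelˡ-≤ x (sideCount H) x
      (≤-trans (+-monoˡ-≤ (sideCount H) x≤c₀) (≤-trans (≤-reflexive sideCount-halves) (2^m≤xval+xval m 1≤m)))

  arc-cuts : ∀ t → t ≤ H → (ρ : Routing (suc m)) → ∃[ g₁ ] ∃[ g₂ ] boundary (suc m) (arc t) ≤ cut η ρ g₁ + cut η ρ g₂
  arc-cuts t t≤H ρ with cw-surjective N (toℕ j) t (toℕ<n j) (≤-<-trans t≤H H<N)
  ... | q , q<N , jq≡t with gap-before N q H q<N (m^n>0 2 m) (<⇒≤ H<N) | gap-before N q N q<N (m^n>0 2 (suc m)) ≤-refl
  ...   | g₁ , g₁-end | g₂ , g₂-end = g₁ , g₂ , ArcCuts.boundary≤cuts η ρ (arc t) H q g₁ g₂ q<N inside outside g₁-end g₂-end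
    where
    inside : ∀ v → arc t v ≡ true → cw N q (pos η v) < H
    inside v v∈ = shifted-arc⇒arc N H (toℕ j) q (pos η v) t (toℕ<n j) q<N (pos<N v) jq≡t
                    (proj₁ (inWindow⇒ H t (offset v) v∈)) (proj₂ (inWindow⇒ H t (offset v) v∈))
    outside : ∀ v → arc t v ≡ false → H ≤ cw N q (pos η v)
    outside v v∉ = ≮⇒≥ λ qv<H →
      contradiction (trans (sym v∉) (inWindow⇐ H t (offset v) (proj₁ (in-shifted qv<H)) (proj₂ (in-shifted qv<H)))) λ ()
      where
      in-shifted : cw N q (pos η v) < H → t ≤ offset v × offset v < t + H
      in-shifted = arc⇒shifted-arc N H (toℕ j) q (pos η v) t H+H≡N (toℕ<n j) q<N (pos<N v) t≤H jq≡t

theorem1 : (n : ℕ) → 2 ≤ n → (η : Embedding n) →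
    (∃[ i ] ∃[ b ] ∃[ j ] xval n ≤ inArcCount η i b j) →
    (ρ : Routing n) → ∃[ g ] bound n ≤ cut η ρ g
theorem1 (suc m) (s≤s 1≤m) η (i , b , j , x≤count) ρ =
  let t , t≤H , balanced = balanced-arc 1≤m (subst (xval (suc m) ≤_) inArcCount≡sideCount x≤count)
      g₁ , g₂ , ∂≤cuts = arc-cuts t t≤H ρ
      2bound≤∂ = boundary-of-balanced-set m 1≤m i b (arc t) (arc-size t t≤H) (trans (sym (sideCount≡size t)) balanced)
  in one-of-two-exceeds (cut η ρ) g₁ g₂ _ _ 2bound≤∂ ∂≤cuts
  where open ArcSweep η i b j
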